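{- Let $q=p^r$ be a power of a prime $p$ and $n\ge1$ an integer. Let $B\subset\mathbb{F}_q^\times$ be a set of representatives of the cosets of $\mathbb{F}_p^\times$ in $\mathbb{F}_q^\times$. For $\alpha\in\mathbb{F}_q^\times$ and $\beta\in B$ let $C_{\alpha,\beta}$ be the curve over $\mathbb{F}_q$ given by $x(y^p-y)=\beta(\alpha x^2-1)$, i.e. the projective plane curve $xy^p-xyz^{p-1}=\beta(\alpha x^2z^{p-1}-z^{p+1})$, and let $S_{\alpha,\beta}(\mathbb{F}_{q^n})=\#C_{\alpha,\beta}(\mathbb{F}_{q^n})-(q^n+1)$, where $\#C_{\alpha,\beta}(\mathbb{F}_{q^n})$ is the number of its points in $\mathbb{P}^2(\mathbb{F}_{q^n})$. Then \[ F_q(n,0,0)=q^{n-2}+\frac{(q-1)^2}{q^2}+\frac1{q^2}\sum_{\alpha\in\mathbb{F}_q^\times}\sum_{\beta\in B}S_{\alpha,\beta}(\mathbb{F}_{q^n}). \]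
   Context: For $a\in\mathbb{F}_{q^n}$, $\mathrm{Tr}(a)=\sum_{i=0}^{n-1}a^{q^i}$ and $\mathrm{rTr}(a)=\sum_{i=0}^{n-1}a^{ -q^i}$, with the convention $\mathrm{rTr}(0)=0$. $F_q(n,0,0)$ is the number of $a\in\mathbb{F}_{q^n}$ with $\mathrm{Tr}(a)=0$ and $\mathrm{rTr}(a)=0$. -}

module Defs where

open import Level using (0ℓ)
open import Data.Nat as ℕ using (ℕ; zero; suc)
open import Data.Integer as ℤ using (ℤ; +_)
open import Data.List using (List; []; _∷_; filter; length; map; foldr)
open import Data.List.Membership.Propositional using (_∈_)
open import Data.List.Relation.Unary.Unique.Propositional using (Unique)
open import Data.Product using (Σ; ∃; _×_; _,_)
open import Relation.Nullary using (¬_; Dec; yes; no; _×-dec_; ¬?)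
open import Relation.Binary.PropositionalEquality using (_≡_; _≢_)
open import Relation.Binary.Definitions using (DecidableEquality)
open import Algebra.Structures using (IsCommutativeRing)

record FiniteField : Set₁ where
  infixl 6 _+_
  infixl 7 _*_
  field
    Carrier  : Set
    _+_ _*_  : Carrier → Carrier → Carrier
    -_       : Carrier → Carrier
    0# 1#    : Carrier
    isCommutativeRing : IsCommutativeRing _≡_ _+_ _*_ -_ 0# 1#
    0≢1      : 0# ≢ 1#
    inverse  : ∀ x → x ≢ 0# → Σ Carrier (λ y → x * y ≡ 1#)
    _≟_      : DecidableEquality Carrier
    elements : List Carrier
    complete : ∀ x → x ∈ elements
    unique   : Unique elements

  card : ℕ
  card = length elements

  _^_ : Carrier → ℕ → Carrier
  x ^ zero  = 1#
  x ^ suc k = x * (x ^ k)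

  -- total inverse with the convention 0⁻¹ = 0
  inv : Carrier → Carrier
  inv x with x ≟ 0#
  ... | yes _ = 0#
  ... | no x≢0 with inverse x x≢0
  ... | (y , _) = y

  sumUpTo : ℕ → (ℕ → Carrier) → Carrier
  sumUpTo zero    f = 0#
  sumUpTo (suc m) f = sumUpTo m f + f m

  -- Tr_{F_{q^n}/F_q}(a) = Σ_{i<n} a^{q^i}
  Tr : (q n : ℕ) → Carrier → Carrier
  Tr q n a = sumUpTo n (λ i → a ^ (q ℕ.^ i))

  -- rTr(a) = Σ_{i<n} a^{-q^i}, with rTr(0) = 0
  rTr : (q n : ℕ) → Carrier → Carrier
  rTr q n a with a ≟ 0#
  ... | yes _ = 0#
  ... | no _  = sumUpTo n (λ i → inv a ^ (q ℕ.^ i))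

  -- F_q(n,0,0) = #{a : Tr a = 0 and rTr a = 0}
  Fq00 : (q n : ℕ) → ℕ
  Fq00 q n = length (filter (λ a → (Tr q n a ≟ 0#) ×-dec (rTr q n a ≟ 0#)) elements)

  -- membership in the subfield with m elements: x^m = x
  InSub : ℕ → Carrier → Set
  InSub m x = x ^ m ≡ x

  subUnits : ℕ → List Carrier
  subUnits m = filter (λ x → ¬? (x ≟ 0#) ×-dec ((x ^ m) ≟ x)) elements

  record IsCosetReps (p q : ℕ) (B : List Carrier) : Set where
    field
      distinct  : Unique B
      inFqUnits : ∀ β → β ∈ B → β ≢ 0# × InSub q β
      covers    : ∀ γ → γ ≢ 0# → InSub q γ →
                  Σ Carrier (λ β → β ∈ B × Σ Carrier (λ c → c ≢ 0# × InSub p c × γ ≡ c * β))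
      separate  : ∀ β β' → β ∈ B → β' ∈ B → (c : Carrier) → c ≢ 0# → InSub p c →
                  β ≡ c * β' → β ≡ β'

  -- the projective plane P²(L), each point given by its normalised
  -- representative: (1:y:z), (0:1:z), (0:0:1)
  P2 : List (Carrier × Carrier × Carrier)
  P2 = foldr (λ y acc → foldr (λ z acc' → (1# , y , z) ∷ acc') acc elements) [] elements
       Data.List.++ (map (λ z → (0# , 1# , z)) elements
       Data.List.++ ((0# , 0# , 1#) ∷ []))

  curvePoly : (p : ℕ) (α β : Carrier) → Carrier × Carrier × Carrier → Carrier
  curvePoly p α β (x , y , z) =
    (x * (y ^ p) + - (x * y * (z ^ (p ℕ.∸ 1))))
    + - (β * (α * (x ^ 2) * (z ^ (p ℕ.∸ 1)) + - (z ^ (p ℕ.+ 1))))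

  curveCount : (p : ℕ) (α β : Carrier) → ℕ
  curveCount p α β = length (filter (λ P → curvePoly p α β P ≟ 0#) P2)

  -- S_{α,β}(F_{q^n}) = #C_{α,β}(F_{q^n}) - (q^n + 1), where q^n = card
  S : (p : ℕ) (α β : Carrier) → ℤ
  S p α β = + curveCount p α β ℤ.- + (card ℕ.+ 1)

sumℤ : {A : Set} → (A → ℤ) → List A → ℤ
sumℤ f = foldr (λ a s → f a ℤ.+ s) (+ 0)

module Submission where

-- Write L = F_{q^n}, q = p^r, T = Tr_{L/F_q}, and A(c) = #{t ∈ L : t^p - t = c}.
--
-- For β ≠ 0 the curve has exactly two points with xz = 0,
--    and substituting y = tz on the chart x = 1 gives
--        #C_{α,β}(L) = 2 + Σ_{z ≠ 0} A(β(α/z - z)).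
--  * Artin–Schreier.  A(c) = p·[Tr_{L/F_p}(c) = 0], proved by counting:
--    each fibre of t ↦ t^p - t is a coset of F_p or empty, and the image
--    lies in the kernel of the trace, whose size is exactly |L|/p.
--  * Transitivity of the trace, Tr_{L/F_p} = Tr_{F_q/F_p} ∘ T, together with
--    the F_q-linearity of T and the fact that A is invariant under F_p^×,
--    turns the double sum over α ∈ F_q^×, β ∈ B into a sum over pairs
--    (γ, δ) ∈ F_q^× × F_q^× of [Tr_{F_q/F_p}(δ·T(1/z) - γ·T(z)) = 0].
--  * This inner count depends only on whether T(z) and T(1/z) vanish, by
--    equidistribution of Tr_{F_q/F_p}; Tr_{L/F_q} is equidistributed as well,
--    which counts the z with T(z) = 0.  What remains is an identity in ℤ.

open import Defs
open import Data.Nat as ℕ using (ℕ; zero; suc; _≤_; _<_; z≤n; s≤s)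
import Data.Nat.Properties as NP
open import Data.Nat.Primality using (Prime)
open import Data.Integer as ℤ using (ℤ) renaming (+_ to pos)
import Data.Integer.Properties as ℤP
open import Data.List using (List; []; _∷_; map; filter; length; _++_; foldr)
open import Data.List.Membership.Propositional using (_∈_)
import Data.List.Membership.Propositional.Properties as MP
open import Data.List.Relation.Unary.Any using (here; there)
import Data.List.Relation.Unary.All as All
open import Data.List.Relation.Unary.AllPairs using ([]; _∷_)
open import Data.List.Relation.Unary.Unique.Propositional using (Unique)
import Data.List.Relation.Unary.Unique.Propositional.Properties as UP
open import Data.Empty using (⊥-elim)
open import Data.Sum using (_⊎_; inj₁; inj₂)
open import Data.Product using (_×_; _,_; proj₁; proj₂; Σ-syntax)
open import Function using (case_of_)
open import Relation.Nullary using (Dec; yes; no; ¬_; ¬?; _×-dec_)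
open import Relation.Binary.PropositionalEquality

-- The characteristic map ℤ → L, shown to be a ring homomorphism, instantiates
-- the standard library's ring solver with integer coefficients.  This decides
-- polynomial identities with integer constants in the (abstract) field L.
module IntegerRingSolver (L : FiniteField) where
  open import Algebra.Bundles using (CommutativeRing)
  open import Algebra.Solver.Ring.AlmostCommutativeRing
  import Algebra.Properties.Ring as RingProperties
  open import Data.Integer using (-[1+_]; _⊖_)
  open import Data.Maybe using (Maybe; just; nothing)
  open import Data.Sign as Sign using (Sign)

  open FiniteField L using (Carrier; isCommutativeRing)

  commutativeRing : CommutativeRing _ _
  commutativeRing = record { isCommutativeRing = isCommutativeRing }

  open CommutativeRing commutativeRing public hiding (refl; sym; trans; Carrier)
  open RingProperties ring public
    using (-‿distribˡ-*; -‿distribʳ-*; -‿involutive; -‿anti-homo-+; -0#≈0#)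
  open import Algebra.Properties.Semiring.Mult semiring using (×-homo-+; ×1-homo-*) renaming (_×_ to _×ₙ_)
  open ≡-Reasoning

  nat : ℕ → Carrier
  nat n = n ×ₙ 1#

  nat-+ : ∀ m n → nat (m ℕ.+ n) ≡ nat m + nat n
  nat-+ m n = ×-homo-+ 1# m n

  nat-* : ∀ m n → nat (m ℕ.* n) ≡ nat m * nat n
  nat-* = ×1-homo-*

  ι₀ : ℤ → Carrier
  ι₀ (pos n) = nat n
  ι₀ -[1+ n ] = - nat (suc n)

  ι₀-⊖ : ∀ m n → ι₀ (m ⊖ n) ≡ nat m + - nat n
  ι₀-⊖ zero zero = sym (trans (+-identityˡ (- 0#)) -0#≈0#)
  ι₀-⊖ zero (suc n) = sym (+-identityˡ _)
  ι₀-⊖ (suc m) zero = sym (trans (cong (nat (suc m) +_) -0#≈0#) (+-identityʳ _))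
  ι₀-⊖ (suc m) (suc n) = begin
    ι₀ (suc m ⊖ suc n)                    ≡⟨ cong ι₀ (ℤP.[1+m]⊖[1+n]≡m⊖n m n) ⟩
    ι₀ (m ⊖ n)                            ≡⟨ ι₀-⊖ m n ⟩
    nat m + - nat n                       ≡⟨ cong (_+ - nat n) (sym (+-identityˡ _)) ⟩
    (0# + nat m) + - nat n                ≡⟨ cong (λ z → (z + nat m) + - nat n) (sym (-‿inverseʳ 1#)) ⟩
    ((1# + - 1#) + nat m) + - nat n       ≡⟨ cong (_+ - nat n) (+-assoc _ _ _) ⟩
    (1# + (- 1# + nat m)) + - nat n       ≡⟨ cong (λ z → (1# + z) + - nat n) (+-comm _ _) ⟩
    (1# + (nat m + - 1#)) + - nat n       ≡⟨ cong (_+ - nat n) (sym (+-assoc _ _ _)) ⟩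
    ((1# + nat m) + - 1#) + - nat n       ≡⟨ +-assoc _ _ _ ⟩
    (1# + nat m) + (- 1# + - nat n)       ≡⟨ cong ((1# + nat m) +_) (sym (-‿anti-homo-+ _ _)) ⟩
    (1# + nat m) + - (nat n + 1#)         ≡⟨ cong (λ z → (1# + nat m) + - z) (+-comm _ _) ⟩
    (1# + nat m) + - (1# + nat n)         ∎

  ι₀-+ : ∀ i j → ι₀ (i ℤ.+ j) ≡ ι₀ i + ι₀ j
  ι₀-+ (pos m) (pos n) = nat-+ m n
  ι₀-+ (pos m) -[1+ n ] = ι₀-⊖ m (suc n)
  ι₀-+ -[1+ m ] (pos n) = trans (ι₀-⊖ n (suc m)) (+-comm _ _)
  ι₀-+ -[1+ m ] -[1+ n ] = begin
    - nat (suc (suc (m ℕ.+ n)))           ≡⟨ cong (λ z → - nat (suc z)) (trans (cong suc (NP.+-comm m n)) (sym (NP.+-suc n m))) ⟩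
    - nat (suc n ℕ.+ suc m)               ≡⟨ cong -_ (nat-+ (suc n) (suc m)) ⟩
    - (nat (suc n) + nat (suc m))         ≡⟨ -‿anti-homo-+ _ _ ⟩
    - nat (suc m) + - nat (suc n)         ∎

  signed : Sign → Carrier → Carrier
  signed Sign.+ x = x
  signed Sign.- x = - x

  ι₀-◃ : ∀ s n → ι₀ (s ℤ.◃ n) ≡ signed s (nat n)
  ι₀-◃ Sign.+ zero = refl
  ι₀-◃ Sign.- zero = sym -0#≈0#
  ι₀-◃ Sign.+ (suc n) = refl
  ι₀-◃ Sign.- (suc n) = refl

  ι₀-signed : ∀ i → ι₀ i ≡ signed (ℤ.sign i) (nat ℤ.∣ i ∣)
  ι₀-signed (pos zero) = refl
  ι₀-signed (pos (suc n)) = refl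
  ι₀-signed -[1+ n ] = refl

  signed-* : ∀ s t x y → signed (s Sign.* t) (x * y) ≡ signed s x * signed t y
  signed-* Sign.+ Sign.+ x y = refl
  signed-* Sign.+ Sign.- x y = -‿distribʳ-* x y
  signed-* Sign.- Sign.+ x y = -‿distribˡ-* x y
  signed-* Sign.- Sign.- x y =
    trans (sym (-‿involutive _)) (trans (cong -_ (-‿distribˡ-* x y)) (-‿distribʳ-* (- x) y))

  ι₀-* : ∀ i j → ι₀ (i ℤ.* j) ≡ ι₀ i * ι₀ j
  ι₀-* i j = begin
    ι₀ (s ℤ.◃ ℤ.∣ i ∣ ℕ.* ℤ.∣ j ∣)                ≡⟨ ι₀-◃ s (ℤ.∣ i ∣ ℕ.* ℤ.∣ j ∣) ⟩
    signed s (nat (ℤ.∣ i ∣ ℕ.* ℤ.∣ j ∣))          ≡⟨ cong (signed s) (nat-* ℤ.∣ i ∣ ℤ.∣ j ∣) ⟩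
    signed s (nat ℤ.∣ i ∣ * nat ℤ.∣ j ∣)          ≡⟨ signed-* (ℤ.sign i) (ℤ.sign j) _ _ ⟩
    signed (ℤ.sign i) (nat ℤ.∣ i ∣) * signed (ℤ.sign j) (nat ℤ.∣ j ∣)
                                                  ≡⟨ sym (cong₂ _*_ (ι₀-signed i) (ι₀-signed j)) ⟩
    ι₀ i * ι₀ j                                   ∎
    where s = ℤ.sign i Sign.* ℤ.sign j

  ι₀-neg : ∀ i → ι₀ (ℤ.- i) ≡ - ι₀ i
  ι₀-neg (pos zero) = sym -0#≈0#
  ι₀-neg (pos (suc n)) = refl
  ι₀-neg -[1+ n ] = sym (-‿involutive _)

  -- the homomorphism used by the solver sends 1 to 1# on the nose,
  -- so that the solver's unit law holds by reflexivity
  ι : ℤ → Carrier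
  ι (pos 1) = 1#
  ι i = ι₀ i

  ι≡ι₀ : ∀ i → ι i ≡ ι₀ i
  ι≡ι₀ (pos zero) = refl
  ι≡ι₀ (pos (suc zero)) = sym (+-identityʳ 1#)
  ι≡ι₀ (pos (suc (suc n))) = refl
  ι≡ι₀ -[1+ n ] = refl

  ι-+ : ∀ i j → ι (i ℤ.+ j) ≡ ι i + ι j
  ι-+ i j = trans (ι≡ι₀ (i ℤ.+ j)) (trans (ι₀-+ i j) (sym (cong₂ _+_ (ι≡ι₀ i) (ι≡ι₀ j))))

  ι-* : ∀ i j → ι (i ℤ.* j) ≡ ι i * ι j
  ι-* i j = trans (ι≡ι₀ (i ℤ.* j)) (trans (ι₀-* i j) (sym (cong₂ _*_ (ι≡ι₀ i) (ι≡ι₀ j))))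

  ι-neg : ∀ i → ι (ℤ.- i) ≡ - ι i
  ι-neg i = trans (ι≡ι₀ (ℤ.- i)) (trans (ι₀-neg i) (sym (cong -_ (ι≡ι₀ i))))

  ι-homo : ℤ.+-*-rawRing -Raw-AlmostCommutative⟶ fromCommutativeRing commutativeRing
  ι-homo = record
    { ⟦_⟧ = ι ; +-homo = ι-+ ; *-homo = ι-* ; -‿homo = ι-neg ; 0-homo = refl ; 1-homo = refl }

  ι-equal? : ∀ a b → Maybe (ι a ≡ ι b)
  ι-equal? a b with a ℤ.≟ b
  ... | yes e = just (cong ι e)
  ... | no _ = nothing

  open import Algebra.Solver.Ring ℤ.+-*-rawRing (fromCommutativeRing commutativeRing) ι-homo ι-equal? public

  𝟎 𝟏 : ∀ {m} → Polynomial m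
  𝟎 = con (pos 0)
  𝟏 = con (pos 1)

-- Finite sums indexed by lists.  Every list used as an index set is
-- duplicate-free, and sums over two such lists with the same members agree.
module ListSums where
  open import Relation.Binary.Definitions using (DecidableEquality)
  open import Relation.Unary using (Decidable)
  open import Data.Nat.Solver using (module +-*-Solver)

  module Sums {M : Set} (_∙_ : M → M → M) (ε : M)
    (assoc : ∀ a b c → (a ∙ b) ∙ c ≡ a ∙ (b ∙ c))
    (comm : ∀ a b → a ∙ b ≡ b ∙ a)
    (identityˡ : ∀ a → ε ∙ a ≡ a) where

    identityʳ : ∀ a → a ∙ ε ≡ a
    identityʳ a = trans (comm a ε) (identityˡ a)

    module _ {A : Set} where
      Σ : List A → (A → M) → M
      Σ [] f = ε
      Σ (x ∷ xs) f = f x ∙ Σ xs f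

      Σ-cong : ∀ xs {f g : A → M} → (∀ x → x ∈ xs → f x ≡ g x) → Σ xs f ≡ Σ xs g
      Σ-cong [] h = refl
      Σ-cong (x ∷ xs) h = cong₂ _∙_ (h x (here refl)) (Σ-cong xs (λ y m → h y (there m)))

      Σ-ε : ∀ xs {f : A → M} → (∀ x → x ∈ xs → f x ≡ ε) → Σ xs f ≡ ε
      Σ-ε [] h = refl
      Σ-ε (x ∷ xs) h = trans (cong₂ _∙_ (h x (here refl)) (Σ-ε xs (λ y m → h y (there m)))) (identityˡ ε)

      interchange : ∀ a b c d → (a ∙ b) ∙ (c ∙ d) ≡ (a ∙ c) ∙ (b ∙ d)
      interchange a b c d = begin
        (a ∙ b) ∙ (c ∙ d)  ≡⟨ assoc a b (c ∙ d) ⟩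
        a ∙ (b ∙ (c ∙ d))  ≡⟨ cong (a ∙_) (sym (assoc b c d)) ⟩
        a ∙ ((b ∙ c) ∙ d)  ≡⟨ cong (λ u → a ∙ (u ∙ d)) (comm b c) ⟩
        a ∙ ((c ∙ b) ∙ d)  ≡⟨ cong (a ∙_) (assoc c b d) ⟩
        a ∙ (c ∙ (b ∙ d))  ≡⟨ sym (assoc a c (b ∙ d)) ⟩
        (a ∙ c) ∙ (b ∙ d)  ∎
        where open ≡-Reasoning

      Σ-∙ : ∀ xs (f g : A → M) → Σ xs (λ x → f x ∙ g x) ≡ Σ xs f ∙ Σ xs g
      Σ-∙ [] f g = sym (identityˡ ε)
      Σ-∙ (x ∷ xs) f g = trans (cong ((f x ∙ g x) ∙_) (Σ-∙ xs f g)) (interchange _ _ _ _)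

      Σ-++ : ∀ xs ys (f : A → M) → Σ (xs ++ ys) f ≡ Σ xs f ∙ Σ ys f
      Σ-++ [] ys f = sym (identityˡ _)
      Σ-++ (x ∷ xs) ys f = trans (cong (f x ∙_) (Σ-++ xs ys f)) (sym (assoc _ _ _))

    Σ-map : ∀ {A B : Set} (g : A → B) xs (f : B → M) → Σ (map g xs) f ≡ Σ xs (λ x → f (g x))
    Σ-map g [] f = refl
    Σ-map g (x ∷ xs) f = cong (f (g x) ∙_) (Σ-map g xs f)

    Σ-swap : ∀ {A B : Set} (xs : List A) (ys : List B) (f : A → B → M) →
             Σ xs (λ x → Σ ys (f x)) ≡ Σ ys (λ y → Σ xs (λ x → f x y))
    Σ-swap [] ys f = sym (Σ-ε ys (λ _ _ → refl))
    Σ-swap (x ∷ xs) ys f =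
      trans (cong (Σ ys (f x) ∙_) (Σ-swap xs ys f)) (sym (Σ-∙ ys (f x) (λ y → Σ xs (λ x' → f x' y))))

    module Reindex {A : Set} (_≟_ : DecidableEquality A) where
      sel : A → A → M → M
      sel a b v with a ≟ b
      ... | yes _ = v
      ... | no _ = ε

      sel-sym : ∀ a b v → sel a b v ≡ sel b a v
      sel-sym a b v with a ≟ b | b ≟ a
      ... | yes _ | yes _ = refl
      ... | no _ | no _ = refl
      ... | yes e | no n = ⊥-elim (n (sym e))
      ... | no n | yes e = ⊥-elim (n (sym e))

      Σ-single : ∀ zs (g : A → M) a → Unique zs → a ∈ zs → Σ zs (λ z → sel z a (g z)) ≡ g a
      Σ-single (z ∷ zs) g a (z∉ ∷ u) m with z ≟ a
      ... | yes refl = trans (cong (g z ∙_) (Σ-ε zs others)) (identityʳ _)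
        where
        others : ∀ y → y ∈ zs → sel y z (g y) ≡ ε
        others y y∈ with y ≟ z
        ... | no _ = refl
        ... | yes refl = ⊥-elim (All.lookup z∉ y∈ refl)
      ... | no z≢a with m
      ...   | here e = ⊥-elim (z≢a (sym e))
      ...   | there m' = trans (identityˡ _) (Σ-single zs g a u m')

      Σ-perm : ∀ xs ys (f : A → M) → Unique xs → Unique ys →
               (∀ {x} → x ∈ xs → x ∈ ys) → (∀ {x} → x ∈ ys → x ∈ xs) → Σ xs f ≡ Σ ys f
      Σ-perm xs ys f ux uy xy yx = begin
        Σ xs f                                     ≡⟨ Σ-cong xs (λ x x∈ → sym (Σ-single ys f x uy (xy x∈))) ⟩
        Σ xs (λ x → Σ ys (λ y → sel y x (f y)))    ≡⟨ Σ-swap xs ys _ ⟩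
        Σ ys (λ y → Σ xs (λ x → sel y x (f y)))    ≡⟨ Σ-cong ys (λ y _ → Σ-cong xs (λ x _ → sel-sym y x (f y))) ⟩
        Σ ys (λ y → Σ xs (λ x → sel x y (f y)))    ≡⟨ Σ-cong ys (λ y y∈ → Σ-single xs (λ _ → f y) y ux (yx y∈)) ⟩
        Σ ys f                                     ∎
        where open ≡-Reasoning

      map-unique : ∀ {B : Set} (σ : A → B) xs → Unique xs →
        (∀ {a b} → a ∈ xs → b ∈ xs → σ a ≡ σ b → a ≡ b) → Unique (map σ xs)
      map-unique σ [] u inj = []
      map-unique σ (x ∷ xs) (x∉ ∷ u) inj =
        AllP.map⁺ (All.tabulate (λ {y} y∈ e → All.lookup x∉ y∈ (inj (here refl) (there y∈) e))) ∷
          map-unique σ xs u (λ a b e → inj (there a) (there b) e)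
        where import Data.List.Relation.Unary.All.Properties as AllP

      Σ-bij : ∀ xs ys (σ τ : A → A) (f : A → M) → Unique xs → Unique ys →
        (∀ {x} → x ∈ xs → σ x ∈ ys) → (∀ {y} → y ∈ ys → τ y ∈ xs) →
        (∀ {x} → x ∈ xs → τ (σ x) ≡ x) → (∀ {y} → y ∈ ys → σ (τ y) ≡ y) →
        Σ xs (λ x → f (σ x)) ≡ Σ ys f
      Σ-bij xs ys σ τ f ux uy σ∈ τ∈ τσ στ =
        trans (sym (Σ-map σ xs f))
          (Σ-perm (map σ xs) ys f
            (map-unique σ xs ux (λ {a} {b} a∈ b∈ e → trans (sym (τσ a∈)) (trans (cong τ e) (τσ b∈))))
            uy
            (λ m → case MP.∈-map⁻ σ m of λ { (x , x∈ , refl) → σ∈ x∈ })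
            (λ {y} m → subst (_∈ map σ xs) (στ m) (MP.∈-map⁺ σ (τ∈ m))))

  module ℕSum where
    open Sums ℕ._+_ 0 NP.+-assoc NP.+-comm (λ _ → refl) public
    open +-*-Solver

    ind : ∀ {P : Set} → Dec P → ℕ
    ind (yes _) = 1
    ind (no _) = 0

    pick : ∀ {P : Set} → Dec P → ℕ → ℕ → ℕ
    pick (yes _) a b = a
    pick (no _) a b = b

    module _ {A : Set} where
      count : {P : A → Set} → Decidable P → List A → ℕ
      count P? xs = Σ xs (λ x → ind (P? x))

      length-filter : {P : A → Set} (P? : Decidable P) → ∀ xs → length (filter P? xs) ≡ count P? xs
      length-filter P? [] = refl
      length-filter P? (x ∷ xs) with P? x
      ... | yes _ = cong suc (length-filter P? xs)
      ... | no _ = length-filter P? xs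

      Σ-const : ∀ (xs : List A) c → Σ xs (λ _ → c) ≡ length xs ℕ.* c
      Σ-const [] c = refl
      Σ-const (x ∷ xs) c = cong (c ℕ.+_) (Σ-const xs c)

      Σ-one : ∀ (xs : List A) → Σ xs (λ _ → 1) ≡ length xs
      Σ-one xs = trans (Σ-const xs 1) (NP.*-identityʳ _)

      Σ-mono : ∀ xs {f g : A → ℕ} → (∀ x → x ∈ xs → f x ≤ g x) → Σ xs f ≤ Σ xs g
      Σ-mono [] h = z≤n
      Σ-mono (x ∷ xs) h = NP.+-mono-≤ (h x (here refl)) (Σ-mono xs (λ y m → h y (there m)))

      Σ-*ˡ : ∀ xs c (f : A → ℕ) → Σ xs (λ x → c ℕ.* f x) ≡ c ℕ.* Σ xs f
      Σ-*ˡ [] c f = sym (NP.*-zeroʳ c)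
      Σ-*ˡ (x ∷ xs) c f = trans (cong (c ℕ.* f x ℕ.+_) (Σ-*ˡ xs c f)) (sym (NP.*-distribˡ-+ c (f x) _))

      Σ-eq-pointwise : ∀ xs (f g : A → ℕ) → (∀ x → x ∈ xs → f x ≤ g x) → Σ xs f ≡ Σ xs g →
                       ∀ x → x ∈ xs → f x ≡ g x
      Σ-eq-pointwise (y ∷ xs) f g le eq x m = case m of λ
        { (here refl) → head
        ; (there m') → Σ-eq-pointwise xs f g (λ z m → le z (there m))
                         (NP.+-cancelˡ-≡ (f y) _ _ (trans eq (cong (ℕ._+ Σ xs g) (sym head)))) x m' }
        where
        rest≤ : Σ xs f ≤ Σ xs g
        rest≤ = Σ-mono xs (λ z m → le z (there m))
        head : f y ≡ g y
        head with NP.m≤n⇒m<n∨m≡n (le y (here refl))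
        ... | inj₂ e = e
        ... | inj₁ lt = ⊥-elim (NP.<⇒≢ (NP.+-mono-<-≤ lt rest≤) eq)

      squeeze : ∀ ws (f : A → ℕ) b k → 0 < b → Σ ws f ≡ k ℕ.* b → (∀ w → w ∈ ws → f w ≤ b) →
                length ws ≤ k → (length ws ≡ k) × (∀ w → w ∈ ws → f w ≡ b)
      squeeze ws f b k b>0 eq le lk =
        |ws| , Σ-eq-pointwise ws f (λ _ → b) le (trans eq (trans (cong (ℕ._* b) (sym |ws|)) (sym (Σ-const ws b))))
        where
        kb≤ : k ℕ.* b ≤ length ws ℕ.* b
        kb≤ = NP.≤-trans (NP.≤-reflexive (sym eq)) (NP.≤-trans (Σ-mono ws le) (NP.≤-reflexive (Σ-const ws b)))
        |ws| : length ws ≡ k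
        |ws| = NP.≤-antisym lk (NP.*-cancelʳ-≤ k (length ws) b {{ℕ.>-nonZero b>0}} kb≤)

    count-split : ∀ {A : Set} {P : A → Set} (P? : Decidable P) xs →
      count P? xs ℕ.+ count (λ x → ¬? (P? x)) xs ≡ length xs
    count-split P? [] = refl
    count-split P? (x ∷ xs) with P? x
    ... | yes _ = cong suc (count-split P? xs)
    ... | no _ = trans (NP.+-suc _ _) (cong suc (count-split P? xs))

    count-cong : ∀ {A : Set} {P Q : A → Set} (P? : Decidable P) (Q? : Decidable Q) xs →
      (∀ x → x ∈ xs → P x → Q x) → (∀ x → x ∈ xs → Q x → P x) → count P? xs ≡ count Q? xs
    count-cong P? Q? xs pq qp = Σ-cong xs same
      where
      same : ∀ x → x ∈ xs → ind (P? x) ≡ ind (Q? x)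
      same x m with P? x | Q? x
      ... | yes _ | yes _ = refl
      ... | no _ | no _ = refl
      ... | yes a | no b = ⊥-elim (b (pq x m a))
      ... | no a | yes b = ⊥-elim (a (qp x m b))

    count-none : ∀ {A : Set} {P : A → Set} (P? : Decidable P) xs → (∀ x → x ∈ xs → ¬ P x) → count P? xs ≡ 0
    count-none P? xs h = Σ-ε xs zero-term
      where
      zero-term : ∀ x → x ∈ xs → ind (P? x) ≡ 0
      zero-term x m with P? x
      ... | yes a = ⊥-elim (h x m a)
      ... | no _ = refl

    -- Σ_x pick(P x, a, b) = #P·a + #¬P·b, in subtraction-free form
    Σ-pick : ∀ {A : Set} {P : A → Set} (P? : Decidable P) xs a b →
      Σ xs (λ x → pick (P? x) a b) ℕ.+ count P? xs ℕ.* b ≡ count P? xs ℕ.* a ℕ.+ length xs ℕ.* b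
    Σ-pick P? [] a b = refl
    Σ-pick P? (x ∷ xs) a b with P? x
    ... | yes _ = begin
        (a ℕ.+ S) ℕ.+ (b ℕ.+ c ℕ.* b)      ≡⟨ solve 4 (λ a b s cb → (a :+ s) :+ (b :+ cb) := a :+ (s :+ cb) :+ b) refl a b S (c ℕ.* b) ⟩
        a ℕ.+ (S ℕ.+ c ℕ.* b) ℕ.+ b        ≡⟨ cong (λ w → a ℕ.+ w ℕ.+ b) (Σ-pick P? xs a b) ⟩
        a ℕ.+ (c ℕ.* a ℕ.+ l ℕ.* b) ℕ.+ b  ≡⟨ solve 4 (λ a b ca lb → a :+ (ca :+ lb) :+ b := (a :+ ca) :+ (b :+ lb)) refl a b (c ℕ.* a) (l ℕ.* b) ⟩
        (a ℕ.+ c ℕ.* a) ℕ.+ (b ℕ.+ l ℕ.* b) ∎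
      where
      open ≡-Reasoning
      S = Σ xs (λ x → pick (P? x) a b)
      c = count P? xs
      l = length xs
    ... | no _ = begin
        (b ℕ.+ S) ℕ.+ c ℕ.* b               ≡⟨ NP.+-assoc b _ _ ⟩
        b ℕ.+ (S ℕ.+ c ℕ.* b)               ≡⟨ cong (b ℕ.+_) (Σ-pick P? xs a b) ⟩
        b ℕ.+ (c ℕ.* a ℕ.+ l ℕ.* b)         ≡⟨ solve 3 (λ b ca lb → b :+ (ca :+ lb) := ca :+ (b :+ lb)) refl b (c ℕ.* a) (l ℕ.* b) ⟩
        c ℕ.* a ℕ.+ (b ℕ.+ l ℕ.* b)         ∎
      where
      open ≡-Reasoning
      S = Σ xs (λ x → pick (P? x) a b)
      c = count P? xs
      l = length xs

    module Fibres {B : Set} (_≟_ : DecidableEquality B) where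
      open Reindex _≟_ public

      sel-ind : ∀ a b → sel a b 1 ≡ ind (a ≟ b)
      sel-ind a b with a ≟ b
      ... | yes _ = refl
      ... | no _ = refl

      fibre-sum : ∀ {A : Set} (xs : List A) ws (h : A → B) (f : A → ℕ) → Unique ws → (∀ x → x ∈ xs → h x ∈ ws) →
                  Σ xs f ≡ Σ ws (λ w → Σ xs (λ x → sel (h x) w (f x)))
      fibre-sum xs ws h f uw hin = begin
        Σ xs f                                         ≡⟨ Σ-cong xs (λ x x∈ → sym (Σ-single ws (λ _ → f x) (h x) uw (hin x x∈))) ⟩
        Σ xs (λ x → Σ ws (λ w → sel w (h x) (f x)))    ≡⟨ Σ-swap xs ws _ ⟩
        Σ ws (λ w → Σ xs (λ x → sel w (h x) (f x)))    ≡⟨ Σ-cong ws (λ w _ → Σ-cong xs (λ x _ → sel-sym w (h x) (f x))) ⟩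
        Σ ws (λ w → Σ xs (λ x → sel (h x) w (f x)))    ∎
        where open ≡-Reasoning

      count-eq : ∀ xs a → Unique xs → a ∈ xs → count (λ x → x ≟ a) xs ≡ 1
      count-eq xs a u m = trans (Σ-cong xs (λ x _ → sym (sel-ind x a))) (Σ-single xs (λ _ → 1) a u m)

module Binomial where
  open import Data.Nat using (_+_; _*_)
  open import Data.Nat.Divisibility using (_∣_; divides; ∣⇒≤)
  open import Data.Nat.Primality using (euclidsLemma)
  open import Data.Nat.Solver using (module +-*-Solver)
  open +-*-Solver

  bin : ℕ → ℕ → ℕ
  bin n zero = 1
  bin zero (suc k) = 0
  bin (suc n) (suc k) = bin n k + bin n (suc k)

  bin-> : ∀ n k → n < k → bin n k ≡ 0
  bin-> zero (suc k) _ = refl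
  bin-> (suc n) (suc k) (s≤s lt) = cong₂ _+_ (bin-> n k lt) (bin-> n (suc k) (NP.m≤n⇒m≤1+n lt))

  bin-1 : ∀ n → bin n 1 ≡ n
  bin-1 zero = refl
  bin-1 (suc n) = cong suc (bin-1 n)

  bin-diag : ∀ n → bin n n ≡ 1
  bin-diag zero = refl
  bin-diag (suc n) = cong₂ _+_ (bin-diag n) (bin-> n (suc n) (NP.n<1+n n))

  absorb : ∀ n k → suc k * bin (suc n) (suc k) ≡ suc n * bin n k
  absorb zero zero = refl
  absorb zero (suc k) = NP.*-zeroʳ (suc (suc k))
  absorb (suc n) zero = begin
    1 * (1 + bin (suc n) 1)   ≡⟨ cong (λ z → 1 * (1 + z)) (bin-1 (suc n)) ⟩
    1 * (1 + suc n)           ≡⟨ solve 1 (λ n → con 1 :* (con 1 :+ (con 1 :+ n)) := (con 2 :+ n) :* con 1) refl n ⟩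
    suc (suc n) * 1           ∎
    where open ≡-Reasoning
  absorb (suc n) (suc j) = begin
    suc (suc j) * (bin (suc n) (suc j) + bin (suc n) (suc (suc j)))
      ≡⟨ NP.*-distribˡ-+ (suc (suc j)) (bin (suc n) (suc j)) _ ⟩
    suc (suc j) * bin (suc n) (suc j) + suc (suc j) * bin (suc n) (suc (suc j))
      ≡⟨ cong (suc (suc j) * bin (suc n) (suc j) +_) (absorb n (suc j)) ⟩
    (bin (suc n) (suc j) + suc j * bin (suc n) (suc j)) + suc n * bin n (suc j)
      ≡⟨ cong (λ z → (bin (suc n) (suc j) + z) + suc n * bin n (suc j)) (absorb n j) ⟩
    (bin (suc n) (suc j) + suc n * bin n j) + suc n * bin n (suc j)
      ≡⟨ solve 4 (λ a m b c → (a :+ m :* b) :+ m :* c := a :+ m :* (b :+ c)) refl (bin (suc n) (suc j)) (suc n) (bin n j) (bin n (suc j)) ⟩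
    bin (suc n) (suc j) + suc n * bin (suc n) (suc j) ∎
    where open ≡-Reasoning

  -- p divides k·C(p,k) = p·C(p-1,k-1) but not k, hence divides C(p,k)
  prime-∣-bin : ∀ p k → Prime p → 0 < k → k < p → p ∣ bin p k
  prime-∣-bin (suc n) (suc j) pp _ lt
    with euclidsLemma (suc j) (bin (suc n) (suc j)) pp
           (divides (bin n j) (trans (absorb n j) (NP.*-comm (suc n) (bin n j))))
  ... | inj₂ d = d
  ... | inj₁ d = ⊥-elim (NP.<⇒≱ lt (∣⇒≤ d))

module FieldFacts (L : FiniteField) where
  open ListSums
  open Binomial
  open IntegerRingSolver L public
  open FiniteField L public
    using (Carrier; _^_; inv; inverse; _≟_; elements; complete; unique; 0≢1; sumUpTo; Tr; rTr; card; Fq00;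
           subUnits; InSub; IsCosetReps; P2; curvePoly; curveCount; S)
  open ≡-Reasoning

  add-cancelʳ : ∀ a b c → a + c ≡ b + c → a ≡ b
  add-cancelʳ a b c e = begin
    a ≡⟨ solve 2 (λ a c → a := (a :+ c) :- c) refl a c ⟩
    (a + c) + - c ≡⟨ cong (_+ - c) e ⟩
    (b + c) + - c ≡⟨ solve 2 (λ b c → (b :+ c) :- c := b) refl b c ⟩
    b ∎

  x-y≡0⇒x≡y : ∀ a b → a + - b ≡ 0# → a ≡ b
  x-y≡0⇒x≡y a b e = add-cancelʳ a b (- b) (trans e (sym (-‿inverseʳ b)))

  x≡y⇒x-y≡0 : ∀ a b → a ≡ b → a + - b ≡ 0#
  x≡y⇒x-y≡0 a b refl = -‿inverseʳ a

  inv-r : ∀ x → x ≢ 0# → x * inv x ≡ 1#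
  inv-r x x≢0 with x ≟ 0#
  ... | yes e = ⊥-elim (x≢0 e)
  ... | no n with inverse x n
  ... | (y , e) = e

  inv-0 : inv 0# ≡ 0#
  inv-0 with 0# ≟ 0#
  ... | yes _ = refl
  ... | no n = ⊥-elim (n refl)

  1≢0 : 1# ≢ 0#
  1≢0 e = 0≢1 (sym e)

  intdom : ∀ x y → x * y ≡ 0# → x ≡ 0# ⊎ y ≡ 0#
  intdom x y e with x ≟ 0#
  ... | yes x0 = inj₁ x0
  ... | no x≢0 = inj₂ (begin
    y ≡⟨ sym (*-identityˡ y) ⟩
    1# * y ≡⟨ cong (_* y) (sym (inv-r x x≢0)) ⟩
    (x * inv x) * y ≡⟨ solve 3 (λ x i y → (x :* i) :* y := i :* (x :* y)) refl x (inv x) y ⟩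
    inv x * (x * y) ≡⟨ cong (inv x *_) e ⟩
    inv x * 0# ≡⟨ zeroʳ _ ⟩
    0# ∎)

  *≢0 : ∀ {x y} → x ≢ 0# → y ≢ 0# → x * y ≢ 0#
  *≢0 {x} {y} a b e with intdom x y e
  ... | inj₁ q = a q
  ... | inj₂ q = b q

  inv≢0 : ∀ x → x ≢ 0# → inv x ≢ 0#
  inv≢0 x x≢0 e = 1≢0 (trans (sym (inv-r x x≢0)) (trans (cong (x *_) e) (zeroʳ x)))

  *-cancelˡ : ∀ s a b → s ≢ 0# → s * a ≡ s * b → a ≡ b
  *-cancelˡ s a b s≢0 e = x-y≡0⇒x≡y a b (case intdom s (a + - b) factored of λ
    { (inj₁ w) → ⊥-elim (s≢0 w) ; (inj₂ w) → w })
    where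
    factored : s * (a + - b) ≡ 0#
    factored = trans (solve 3 (λ s a b → s :* (a :- b) := s :* a :- s :* b) refl s a b) (x≡y⇒x-y≡0 _ _ e)

  inv-unique : ∀ x y → x * y ≡ 1# → inv x ≡ y
  inv-unique x y e = begin
    inv x ≡⟨ sym (*-identityʳ (inv x)) ⟩
    inv x * 1# ≡⟨ cong (inv x *_) (sym e) ⟩
    inv x * (x * y) ≡⟨ solve 3 (λ i x y → i :* (x :* y) := (x :* i) :* y) refl (inv x) x y ⟩
    (x * inv x) * y ≡⟨ cong (_* y) (inv-r x x≢0) ⟩
    1# * y ≡⟨ *-identityˡ y ⟩
    y ∎
    where
    x≢0 : x ≢ 0#
    x≢0 x0 = 1≢0 (trans (sym e) (trans (cong (_* y) x0) (zeroˡ y)))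

  inv-inv : ∀ x → inv (inv x) ≡ x
  inv-inv x = h (x ≟ 0#)
    where
    h : Dec (x ≡ 0#) → inv (inv x) ≡ x
    h (yes refl) = trans (cong inv inv-0) inv-0
    h (no x≢0) = inv-unique (inv x) x (trans (*-comm _ _) (inv-r x x≢0))

  inv-* : ∀ x y → inv (x * y) ≡ inv x * inv y
  inv-* x y = h (x ≟ 0#) (y ≟ 0#)
    where
    h : Dec (x ≡ 0#) → Dec (y ≡ 0#) → inv (x * y) ≡ inv x * inv y
    h (yes refl) _ = trans (cong inv (zeroˡ y)) (trans inv-0 (trans (sym (zeroˡ (inv y))) (cong (_* inv y) (sym inv-0))))
    h (no _) (yes refl) = trans (cong inv (zeroʳ x)) (trans inv-0 (trans (sym (zeroʳ (inv x))) (cong (inv x *_) (sym inv-0))))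
    h (no a) (no b) = inv-unique (x * y) (inv x * inv y) (begin
      (x * y) * (inv x * inv y) ≡⟨ solve 4 (λ x y i j → (x :* y) :* (i :* j) := (x :* i) :* (y :* j)) refl x y (inv x) (inv y) ⟩
      (x * inv x) * (y * inv y) ≡⟨ cong₂ _*_ (inv-r x a) (inv-r y b) ⟩
      1# * 1# ≡⟨ *-identityˡ 1# ⟩
      1# ∎)

  ^-+ : ∀ x m n → x ^ (m ℕ.+ n) ≡ x ^ m * x ^ n
  ^-+ x zero n = sym (*-identityˡ _)
  ^-+ x (suc m) n = trans (cong (x *_) (^-+ x m n)) (sym (*-assoc _ _ _))

  *-^ : ∀ x y n → (x * y) ^ n ≡ x ^ n * y ^ n
  *-^ x y zero = sym (*-identityˡ 1#)
  *-^ x y (suc n) = trans (cong ((x * y) *_) (*-^ x y n))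
    (solve 4 (λ x y a b → (x :* y) :* (a :* b) := (x :* a) :* (y :* b)) refl x y (x ^ n) (y ^ n))

  1^ : ∀ n → 1# ^ n ≡ 1#
  1^ zero = refl
  1^ (suc n) = trans (cong (1# *_) (1^ n)) (*-identityˡ 1#)

  ^-* : ∀ x m n → x ^ (m ℕ.* n) ≡ (x ^ m) ^ n
  ^-* x zero n = sym (1^ n)
  ^-* x (suc m) n = begin
    x ^ (n ℕ.+ m ℕ.* n) ≡⟨ ^-+ x n (m ℕ.* n) ⟩
    x ^ n * x ^ (m ℕ.* n) ≡⟨ cong (x ^ n *_) (^-* x m n) ⟩
    x ^ n * (x ^ m) ^ n ≡⟨ sym (*-^ x (x ^ m) n) ⟩
    (x * x ^ m) ^ n ∎

  0^ : ∀ n → 0# ^ suc n ≡ 0#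
  0^ n = zeroˡ _

  ^≢0 : ∀ x n → x ≢ 0# → x ^ n ≢ 0#
  ^≢0 x zero _ = 1≢0
  ^≢0 x (suc n) x≢0 = *≢0 x≢0 (^≢0 x n x≢0)

  ^≡0 : ∀ x n → x ^ n ≡ 0# → x ≡ 0#
  ^≡0 x n e with x ≟ 0#
  ... | yes x0 = x0
  ... | no x≢0 = ⊥-elim (^≢0 x n x≢0 e)

  inv-^ : ∀ x n → inv (x ^ n) ≡ inv x ^ n
  inv-^ x zero = inv-unique 1# 1# (*-identityˡ 1#)
  inv-^ x (suc n) = trans (inv-* x (x ^ n)) (cong (inv x *_) (inv-^ x n))

  range-cong : ∀ n (f g : ℕ → Carrier) → (∀ k → k < n → f k ≡ g k) → sumUpTo n f ≡ sumUpTo n g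
  range-cong zero f g h = refl
  range-cong (suc n) f g h = cong₂ _+_ (range-cong n f g (λ k lt → h k (NP.m≤n⇒m≤1+n lt))) (h n NP.≤-refl)

  range-+ : ∀ n (f g : ℕ → Carrier) → sumUpTo n (λ k → f k + g k) ≡ sumUpTo n f + sumUpTo n g
  range-+ zero f g = sym (+-identityˡ 0#)
  range-+ (suc n) f g = trans (cong (_+ (f n + g n)) (range-+ n f g))
    (solve 4 (λ a b c d → (a :+ b) :+ (c :+ d) := (a :+ c) :+ (b :+ d)) refl _ _ _ _)

  range-*ˡ : ∀ n c (f : ℕ → Carrier) → c * sumUpTo n f ≡ sumUpTo n (λ k → c * f k)
  range-*ˡ zero c f = zeroʳ c
  range-*ˡ (suc n) c f = trans (distribˡ c _ _) (cong (_+ c * f n) (range-*ˡ n c f))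

  range-shift : ∀ n (f : ℕ → Carrier) → sumUpTo (suc n) f ≡ f 0 + sumUpTo n (λ k → f (suc k))
  range-shift zero f = trans (+-identityˡ _) (sym (+-identityʳ _))
  range-shift (suc n) f = trans (cong (_+ f (suc n)) (range-shift n f)) (+-assoc _ _ _)

  range-0 : ∀ n (f : ℕ → Carrier) → (∀ k → k < n → f k ≡ 0#) → sumUpTo n f ≡ 0#
  range-0 n f h = trans (range-cong n f (λ _ → 0#) h) (z n)
    where
    z : ∀ n → sumUpTo n (λ _ → 0#) ≡ 0#
    z zero = refl
    z (suc n) = trans (cong (_+ 0#) (z n)) (+-identityʳ 0#)

  range-split : ∀ m n (f : ℕ → Carrier) → sumUpTo (m ℕ.+ n) f ≡ sumUpTo m f + sumUpTo n (λ k → f (m ℕ.+ k))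
  range-split m zero f = trans (cong (λ z → sumUpTo z f) (NP.+-identityʳ m)) (sym (+-identityʳ _))
  range-split m (suc n) f = begin
    sumUpTo (m ℕ.+ suc n) f ≡⟨ cong (λ z → sumUpTo z f) (NP.+-suc m n) ⟩
    sumUpTo (m ℕ.+ n) f + f (m ℕ.+ n) ≡⟨ cong (_+ f (m ℕ.+ n)) (range-split m n f) ⟩
    (sumUpTo m f + sumUpTo n (λ k → f (m ℕ.+ k))) + f (m ℕ.+ n) ≡⟨ +-assoc _ _ _ ⟩
    sumUpTo m f + sumUpTo (suc n) (λ k → f (m ℕ.+ k)) ∎

  range-swap : ∀ m n (f : ℕ → ℕ → Carrier) → sumUpTo m (λ i → sumUpTo n (f i)) ≡ sumUpTo n (λ j → sumUpTo m (λ i → f i j))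
  range-swap zero n f = sym (range-0 n _ (λ _ _ → refl))
  range-swap (suc m) n f = trans (cong (_+ sumUpTo n (f m)) (range-swap m n f)) (sym (range-+ n _ (f m)))

  blocks : ∀ k r (f : ℕ → Carrier) → sumUpTo (k ℕ.* r) f ≡ sumUpTo k (λ k' → sumUpTo r (λ j → f (k' ℕ.* r ℕ.+ j)))
  blocks zero r f = refl
  blocks (suc k) r f = begin
    sumUpTo (r ℕ.+ k ℕ.* r) f
      ≡⟨ range-split r (k ℕ.* r) f ⟩
    sumUpTo r f + sumUpTo (k ℕ.* r) (λ i → f (r ℕ.+ i))
      ≡⟨ cong (sumUpTo r f +_) (blocks k r (λ i → f (r ℕ.+ i))) ⟩
    sumUpTo r f + sumUpTo k (λ k' → sumUpTo r (λ j → f (r ℕ.+ (k' ℕ.* r ℕ.+ j))))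
      ≡⟨ cong (sumUpTo r f +_) (range-cong k _ _ (λ k' _ → range-cong r _ _ (λ j _ → cong f (sym (NP.+-assoc r (k' ℕ.* r) j))))) ⟩
    sumUpTo r f + sumUpTo k (λ k' → sumUpTo r (λ j → f (suc k' ℕ.* r ℕ.+ j)))
      ≡⟨ sym (range-shift k _) ⟩
    sumUpTo (suc k) (λ k' → sumUpTo r (λ j → f (k' ℕ.* r ℕ.+ j))) ∎

  nat-1 : nat 1 ≡ 1#
  nat-1 = +-identityʳ 1#

  nat-^ : ∀ m k → nat (m ℕ.^ k) ≡ nat m ^ k
  nat-^ m zero = nat-1
  nat-^ m (suc k) = trans (nat-* m (m ℕ.^ k)) (cong (nat m *_) (nat-^ m k))

  binomial : ∀ m x y → (x + y) ^ m ≡ sumUpTo (suc m) (λ k → nat (bin m k) * (x ^ k * y ^ (m ℕ.∸ k)))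
  binomial zero x y = sym (trans (+-identityˡ _) (trans (cong (_* (1# * 1#)) nat-1) (trans (*-identityˡ _) (*-identityˡ _))))
  binomial (suc m) x y = begin
    (x + y) * (x + y) ^ m ≡⟨ cong ((x + y) *_) (binomial m x y) ⟩
    (x + y) * sumUpTo (suc m) a ≡⟨ distribʳ _ _ _ ⟩
    x * sumUpTo (suc m) a + y * sumUpTo (suc m) a ≡⟨ cong₂ _+_ (range-*ˡ (suc m) x a) (range-*ˡ (suc m) y a) ⟩
    sumUpTo (suc m) xa + sumUpTo (suc m) ya ≡⟨ cong (sumUpTo (suc m) xa +_) (range-shift m ya) ⟩
    sumUpTo (suc m) xa + (ya 0 + sumUpTo m (λ k → ya (suc k))) ≡⟨ cong (λ z → sumUpTo (suc m) xa + (z + sumUpTo m (λ k → ya (suc k)))) ya0 ⟩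
    sumUpTo (suc m) xa + (y ^ suc m + sumUpTo m (λ k → ya (suc k))) ≡⟨ cong (λ z → sumUpTo (suc m) xa + (y ^ suc m + z)) (range-cong m _ c yac) ⟩
    sumUpTo (suc m) xa + (y ^ suc m + sumUpTo m c) ≡⟨ solve 3 (λ a b d → a :+ (b :+ d) := b :+ (a :+ (d :+ con (pos 0)))) refl _ _ _ ⟩
    y ^ suc m + (sumUpTo (suc m) xa + (sumUpTo m c + 0#)) ≡⟨ cong (λ z → y ^ suc m + (sumUpTo (suc m) xa + (sumUpTo m c + z))) cm ⟩
    y ^ suc m + (sumUpTo (suc m) xa + sumUpTo (suc m) c) ≡⟨ cong (y ^ suc m +_) (sym (range-+ (suc m) xa c)) ⟩
    y ^ suc m + sumUpTo (suc m) (λ k → xa k + c k) ≡⟨ cong₂ _+_ (sym b0) (range-cong (suc m) _ _ (λ k _ → sym (bs k))) ⟩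
    b 0 + sumUpTo (suc m) (λ k → b (suc k)) ≡⟨ sym (range-shift (suc m) b) ⟩
    sumUpTo (suc (suc m)) b ∎
    where
    a : ℕ → Carrier
    a k = nat (bin m k) * (x ^ k * y ^ (m ℕ.∸ k))
    xa ya c b : ℕ → Carrier
    xa k = x * a k
    ya k = y * a k
    c k = nat (bin m (suc k)) * (x ^ suc k * y ^ (m ℕ.∸ k))
    b k = nat (bin (suc m) k) * (x ^ k * y ^ (suc m ℕ.∸ k))
    ya0 : ya 0 ≡ y ^ suc m
    ya0 = trans (cong (λ z → y * (z * (1# * y ^ m))) nat-1) (cong (y *_) (trans (*-identityˡ _) (*-identityˡ _)))
    yac : ∀ k → k < m → ya (suc k) ≡ c k
    yac k lt = begin
      y * (nat (bin m (suc k)) * (x ^ suc k * y ^ (m ℕ.∸ suc k))) ≡⟨ solve 4 (λ y n a b → y :* (n :* (a :* b)) := n :* (a :* (y :* b))) refl y _ _ _ ⟩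
      nat (bin m (suc k)) * (x ^ suc k * (y * y ^ (m ℕ.∸ suc k))) ≡⟨ cong (λ z → nat (bin m (suc k)) * (x ^ suc k * y ^ z)) (sym (NP.+-∸-assoc 1 lt)) ⟩
      c k ∎
    cm : 0# ≡ c m
    cm = sym (trans (cong (λ z → nat z * (x ^ suc m * y ^ (m ℕ.∸ m))) (bin-> m (suc m) (NP.n<1+n m))) (zeroˡ _))
    b0 : b 0 ≡ y ^ suc m
    b0 = trans (cong (_* (1# * y ^ suc m)) nat-1) (trans (*-identityˡ _) (*-identityˡ _))
    bs : ∀ k → b (suc k) ≡ xa k + c k
    bs k = begin
      nat (bin m k ℕ.+ bin m (suc k)) * (x ^ suc k * y ^ (m ℕ.∸ k)) ≡⟨ cong (_* (x ^ suc k * y ^ (m ℕ.∸ k))) (nat-+ (bin m k) _) ⟩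
      (nat (bin m k) + nat (bin m (suc k))) * (x * x ^ k * y ^ (m ℕ.∸ k))
        ≡⟨ solve 5 (λ n n' x a b → (n :+ n') :* ((x :* a) :* b) := x :* (n :* (a :* b)) :+ n' :* ((x :* a) :* b))
                   refl (nat (bin m k)) (nat (bin m (suc k))) x (x ^ k) (y ^ (m ℕ.∸ k)) ⟩
      xa k + c k ∎

-- The size N = |L| annihilates L, and x^N = x for every x ∈ L: both follow by
-- comparing a sum (resp. product) over L with its translate (resp. dilate).
module FieldOrder (L : FiniteField) where
  open ListSums
  open FieldFacts L public
  open ≡-Reasoning

  module FSum = Sums _+_ 0# +-assoc +-comm +-identityˡ
  module FProd = Sums _*_ 1# *-assoc *-comm *-identityˡ

  E : List Carrier
  E = elements

  N : ℕ
  N = card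

  FSum-const : ∀ (xs : List Carrier) c → FSum.Σ xs (λ _ → c) ≡ nat (length xs) * c
  FSum-const [] c = sym (zeroˡ c)
  FSum-const (x ∷ xs) c = begin
    c + FSum.Σ xs (λ _ → c)        ≡⟨ cong (c +_) (FSum-const xs c) ⟩
    c + nat (length xs) * c        ≡⟨ cong (_+ nat (length xs) * c) (sym (*-identityˡ c)) ⟩
    1# * c + nat (length xs) * c   ≡⟨ sym (distribʳ c 1# (nat (length xs))) ⟩
    nat (suc (length xs)) * c      ∎

  FProd-const : ∀ (xs : List Carrier) c → FProd.Σ xs (λ _ → c) ≡ c ^ length xs
  FProd-const [] c = refl
  FProd-const (x ∷ xs) c = cong (c *_) (FProd-const xs c)

  -- Σ_a (a + x) = Σ_a a, since a ↦ a + x permutes L; hence N·x = 0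
  N·x≡0 : ∀ x → nat N * x ≡ 0#
  N·x≡0 x = add-cancelʳ (nat N * x) 0# Σa (begin
    nat N * x + Σa                   ≡⟨ +-comm _ _ ⟩
    Σa + nat N * x                   ≡⟨ cong (Σa +_) (sym (FSum-const E x)) ⟩
    Σa + FSum.Σ E (λ _ → x)          ≡⟨ sym (FSum.Σ-∙ E (λ a → a) (λ _ → x)) ⟩
    FSum.Σ E (λ a → a + x)           ≡⟨ FSum.Reindex.Σ-bij _≟_ E E (λ a → a + x) (λ a → a + - x) (λ a → a) unique unique
                                          (λ _ → complete _) (λ _ → complete _)
                                          (λ {a} _ → solve 2 (λ a x → (a :+ x) :- x := a) refl a x)
                                          (λ {a} _ → solve 2 (λ a x → (a :- x) :+ x := a) refl a x) ⟩
    Σa                               ≡⟨ sym (+-identityˡ _) ⟩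
    0# + Σa                          ∎)
    where Σa = FSum.Σ E (λ a → a)

  NZ : List Carrier
  NZ = filter (λ x → ¬? (x ≟ 0#)) E

  NZ-unique : Unique NZ
  NZ-unique = UP.filter⁺ (λ x → ¬? (x ≟ 0#)) unique

  NZ-∈ : ∀ {x} → x ≢ 0# → x ∈ NZ
  NZ-∈ {x} n = MP.∈-filter⁺ (λ x → ¬? (x ≟ 0#)) (complete x) n

  NZ-≢ : ∀ {x} → x ∈ NZ → x ≢ 0#
  NZ-≢ m = proj₂ (MP.∈-filter⁻ (λ x → ¬? (x ≟ 0#)) {xs = E} m)

  |NZ|+1 : length NZ ℕ.+ 1 ≡ N
  |NZ|+1 = begin
    length NZ ℕ.+ 1          ≡⟨ cong₂ ℕ._+_ (ℕSum.length-filter nonzero? E) (sym (ℕSum.Fibres.count-eq _≟_ E 0# unique (complete 0#))) ⟩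
    #nonzero ℕ.+ #zero       ≡⟨ NP.+-comm #nonzero #zero ⟩
    #zero ℕ.+ #nonzero       ≡⟨ ℕSum.count-split (λ x → x ≟ 0#) E ⟩
    N                        ∎
    where
    nonzero? = λ x → ¬? (x ≟ 0#)
    #zero = ℕSum.count (λ x → x ≟ 0#) E
    #nonzero = ℕSum.count nonzero? E

  prod≢0 : ∀ xs → (∀ x → x ∈ xs → x ≢ 0#) → FProd.Σ xs (λ a → a) ≢ 0#
  prod≢0 [] h = 1≢0
  prod≢0 (x ∷ xs) h = *≢0 (h x (here refl)) (prod≢0 xs (λ y m → h y (there m)))

  -- Π_{a≠0} (x·a) = Π_{a≠0} a, since a ↦ x·a permutes L^×; hence x^{N-1} = 1
  x^|NZ|≡1 : ∀ x → x ≢ 0# → x ^ length NZ ≡ 1#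
  x^|NZ|≡1 x x≢0 = x-y≡0⇒x≡y _ _ (case intdom _ _ factored of λ
    { (inj₁ e) → e
    ; (inj₂ e) → ⊥-elim (prod≢0 NZ (λ _ → NZ-≢) e) })
    where
    P = FProd.Σ NZ (λ a → a)
    cancel : ∀ u v a → u * v ≡ 1# → v * (u * a) ≡ a
    cancel u v a uv = trans (solve 3 (λ u v a → v :* (u :* a) := (u :* v) :* a) refl u v a)
                            (trans (cong (_* a) uv) (*-identityˡ a))
    dilate : FProd.Σ NZ (λ a → x * a) ≡ P
    dilate = FProd.Reindex.Σ-bij _≟_ NZ NZ (λ a → x * a) (λ a → inv x * a) (λ a → a) NZ-unique NZ-unique
      (λ m → NZ-∈ (*≢0 x≢0 (NZ-≢ m))) (λ m → NZ-∈ (*≢0 (inv≢0 x x≢0) (NZ-≢ m)))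
      (λ {a} _ → cancel x (inv x) a (inv-r x x≢0))
      (λ {a} _ → cancel (inv x) x a (trans (*-comm _ _) (inv-r x x≢0)))
    factored : (x ^ length NZ + - 1#) * P ≡ 0#
    factored = begin
      (x ^ length NZ + - 1#) * P       ≡⟨ solve 2 (λ a b → (a :- con (pos 1)) :* b := a :* b :- b) refl _ P ⟩
      x ^ length NZ * P + - P          ≡⟨ cong (λ z → z * P + - P) (sym (FProd-const NZ x)) ⟩
      FProd.Σ NZ (λ _ → x) * P + - P   ≡⟨ cong (_+ - P) (sym (FProd.Σ-∙ NZ (λ _ → x) (λ a → a))) ⟩
      FProd.Σ NZ (λ a → x * a) + - P   ≡⟨ cong (_+ - P) dilate ⟩
      P + - P                          ≡⟨ -‿inverseʳ P ⟩
      0#                               ∎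

  x^N≡x : ∀ x → x ^ N ≡ x
  x^N≡x x = subst (λ n → x ^ n ≡ x) (trans (NP.+-comm 1 (length NZ)) |NZ|+1) (step (x ≟ 0#))
    where
    step : Dec (x ≡ 0#) → x * x ^ length NZ ≡ x
    step (yes refl) = zeroˡ _
    step (no x≢0) = trans (cong (x *_) (x^|NZ|≡1 x x≢0)) (*-identityʳ x)

  Σ-zero-split : ∀ (h : Carrier → ℕ) → ℕSum.Σ E h ≡ h 0# ℕ.+ ℕSum.Σ NZ h
  Σ-zero-split h = ℕSum.Reindex.Σ-perm _≟_ E (0# ∷ NZ) h unique 0∷NZ-unique to (λ _ → complete _)
    where
    0∷NZ-unique : Unique (0# ∷ NZ)
    0∷NZ-unique = All.tabulate (λ m e → NZ-≢ m (sym e)) ∷ NZ-unique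
    to : ∀ {x} → x ∈ E → x ∈ (0# ∷ NZ)
    to {x} _ with x ≟ 0#
    ... | yes e = here e
    ... | no ne = there (NZ-∈ ne)

module Additivity (L : FiniteField) where
  open Binomial
  open FieldOrder L public
  open import Data.Nat.Divisibility using (divides)
  open import Data.Nat.Primality using (prime⇒nonTrivial)
  open ≡-Reasoning

  Additive : ℕ → Set
  Additive e = ∀ x y → (x + y) ^ e ≡ x ^ e + y ^ e

  prime>1 : ∀ {p} → Prime p → 1 < p
  prime>1 {p} pp = ℕ.nonTrivial⇒n>1 p {{prime⇒nonTrivial pp}}

  0^pos : ∀ e → 0 < e → 0# ^ e ≡ 0#
  0^pos (suc e) _ = 0^ e

  additive-if-middle-vanish : ∀ P → 1 < P → (∀ k → 0 < k → k < P → nat (bin P k) ≡ 0#) → Additive P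
  additive-if-middle-vanish (suc zero) (s≤s ()) middle x y
  additive-if-middle-vanish (suc (suc m)) _ middle x y = begin
    (x + y) ^ P                                   ≡⟨ binomial P x y ⟩
    sumUpTo (suc P) t                             ≡⟨ range-shift P t ⟩
    t 0 + (sumUpTo (suc m) (λ k → t (suc k)) + t P)
                                                  ≡⟨ cong (λ z → t 0 + (z + t P)) (range-0 (suc m) _ inner) ⟩
    t 0 + (0# + t P)                              ≡⟨ cong₂ (λ a b → a + (0# + b)) t0 tP ⟩
    y ^ P + (0# + x ^ P)                          ≡⟨ trans (cong (y ^ P +_) (+-identityˡ _)) (+-comm _ _) ⟩
    x ^ P + y ^ P                                 ∎
    where
    P = suc (suc m)
    t : ℕ → Carrier
    t k = nat (bin P k) * (x ^ k * y ^ (P ℕ.∸ k))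
    inner : ∀ k → k < suc m → t (suc k) ≡ 0#
    inner k lt = trans (cong (_* (x ^ suc k * y ^ (P ℕ.∸ suc k))) (middle (suc k) (s≤s z≤n) (s≤s lt))) (zeroˡ _)
    t0 : t 0 ≡ y ^ P
    t0 = trans (cong (_* (1# * y ^ P)) nat-1) (trans (*-identityˡ _) (*-identityˡ _))
    tP : t P ≡ x ^ P
    tP = begin
      nat (bin P P) * (x ^ P * y ^ (P ℕ.∸ P))   ≡⟨ cong₂ (λ b e → nat b * (x ^ P * y ^ e)) (bin-diag P) (NP.n∸n≡0 P) ⟩
      nat 1 * (x ^ P * 1#)                      ≡⟨ cong (_* (x ^ P * 1#)) nat-1 ⟩
      1# * (x ^ P * 1#)                         ≡⟨ trans (*-identityˡ _) (*-identityʳ _) ⟩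
      x ^ P                                     ∎

  frobenius : ∀ p → Prime p → nat p ≡ 0# → Additive p
  frobenius p pp p≡0 = additive-if-middle-vanish p (prime>1 pp) middle
    where
    middle : ∀ k → 0 < k → k < p → nat (bin p k) ≡ 0#
    middle k k>0 k<p with prime-∣-bin p k pp k>0 k<p
    ... | divides d e = trans (cong nat e) (trans (nat-* d p) (trans (cong (nat d *_) p≡0) (zeroʳ _)))

  Additive-1 : Additive 1
  Additive-1 x y = trans (*-identityʳ _) (sym (cong₂ _+_ (*-identityʳ x) (*-identityʳ y)))

  Additive-* : ∀ a b → Additive a → Additive b → Additive (a ℕ.* b)
  Additive-* a b fa fb x y = begin
    (x + y) ^ (a ℕ.* b)            ≡⟨ ^-* (x + y) a b ⟩
    ((x + y) ^ a) ^ b              ≡⟨ cong (_^ b) (fa x y) ⟩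
    (x ^ a + y ^ a) ^ b            ≡⟨ fb _ _ ⟩
    (x ^ a) ^ b + (y ^ a) ^ b      ≡⟨ sym (cong₂ _+_ (^-* x a b) (^-* y a b)) ⟩
    x ^ (a ℕ.* b) + y ^ (a ℕ.* b)  ∎

  Additive-^ : ∀ e → Additive e → ∀ k → Additive (e ℕ.^ k)
  Additive-^ e fe zero = Additive-1
  Additive-^ e fe (suc k) = Additive-* e (e ℕ.^ k) fe (Additive-^ e fe k)

  Additive-neg : ∀ e → 0 < e → Additive e → ∀ x → (- x) ^ e ≡ - (x ^ e)
  Additive-neg e e>0 fe x = begin
    (- x) ^ e                         ≡⟨ solve 2 (λ a b → a := (b :+ a) :- b) refl _ (x ^ e) ⟩
    (x ^ e + (- x) ^ e) + - (x ^ e)   ≡⟨ cong (_+ - (x ^ e)) (sym (fe x (- x))) ⟩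
    (x + - x) ^ e + - (x ^ e)         ≡⟨ cong (λ z → z ^ e + - (x ^ e)) (-‿inverseʳ x) ⟩
    0# ^ e + - (x ^ e)                ≡⟨ cong (_+ - (x ^ e)) (0^pos e e>0) ⟩
    0# + - (x ^ e)                    ≡⟨ +-identityˡ _ ⟩
    - (x ^ e)                         ∎

  Additive-sum : ∀ e → 0 < e → Additive e → ∀ m f → (sumUpTo m f) ^ e ≡ sumUpTo m (λ i → f i ^ e)
  Additive-sum e e>0 fe zero f = 0^pos e e>0
  Additive-sum e e>0 fe (suc m) f = trans (fe _ _) (cong (_+ f m ^ e) (Additive-sum e e>0 fe m f))

  module FixedField (e : ℕ) (e>0 : 0 < e) (fe : Additive e) where
    fixed-0 : 0# ^ e ≡ 0#
    fixed-0 = 0^pos e e>0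

    fixed-+ : ∀ {a b} → a ^ e ≡ a → b ^ e ≡ b → (a + b) ^ e ≡ a + b
    fixed-+ {a} {b} ha hb = trans (fe a b) (cong₂ _+_ ha hb)

    fixed-* : ∀ {a b} → a ^ e ≡ a → b ^ e ≡ b → (a * b) ^ e ≡ a * b
    fixed-* {a} {b} ha hb = trans (*-^ a b e) (cong₂ _*_ ha hb)

    fixed-neg : ∀ {a} → a ^ e ≡ a → (- a) ^ e ≡ - a
    fixed-neg {a} ha = trans (Additive-neg e e>0 fe a) (cong -_ ha)

    fixed-inv : ∀ {a} → a ^ e ≡ a → inv a ^ e ≡ inv a
    fixed-inv {a} ha = trans (sym (inv-^ a e)) (cong inv ha)

    fixed-^ : ∀ {a} → a ^ e ≡ a → ∀ i → a ^ (e ℕ.^ i) ≡ a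
    fixed-^ {a} ha zero = *-identityʳ a
    fixed-^ {a} ha (suc i) = trans (^-* a e (e ℕ.^ i)) (trans (cong (_^ (e ℕ.^ i)) ha) (fixed-^ ha i))

module Polynomials (L : FiniteField) where
  open ListSums
  open FieldFacts L
  open ≡-Reasoning

  Fn : Set
  Fn = Carrier → Carrier

  -- Le d f: f is a polynomial function of degree at most d
  data Le : ℕ → Fn → Set where
    le0 : ∀ c f → (∀ x → f x ≡ c) → Le 0 f
    leS : ∀ {d} g c f → Le d g → (∀ x → f x ≡ x * g x + c) → Le (suc d) f

  -- Poly d f: f is a polynomial function of degree exactly d
  data Poly : ℕ → Fn → Set where
    p0 : ∀ c f → c ≢ 0# → (∀ x → f x ≡ c) → Poly 0 f
    pS : ∀ {d} g c f → Poly d g → (∀ x → f x ≡ x * g x + c) → Poly (suc d) f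

  Le-ext : ∀ {d f f'} → Le d f → (∀ x → f' x ≡ f x) → Le d f'
  Le-ext (le0 c f h) e = le0 c _ (λ x → trans (e x) (h x))
  Le-ext (leS g c f lg h) e = leS g c _ lg (λ x → trans (e x) (h x))

  Poly-ext : ∀ {d f f'} → Poly d f → (∀ x → f' x ≡ f x) → Poly d f'
  Poly-ext (p0 c f c0 h) e = p0 c _ c0 (λ x → trans (e x) (h x))
  Poly-ext (pS g c f lg h) e = pS g c _ lg (λ x → trans (e x) (h x))

  Le-const : ∀ c → Le 0 (λ _ → c)
  Le-const c = le0 c _ (λ _ → refl)

  Le-add : ∀ {d f g} → Le d f → Le d g → Le d (λ x → f x + g x)
  Le-add (le0 c f h) (le0 c' g h') = le0 (c + c') _ (λ x → cong₂ _+_ (h x) (h' x))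
  Le-add (leS f1 c f l h) (leS g1 c' g l' h') = leS _ (c + c') _ (Le-add l l')
    (λ x → trans (cong₂ _+_ (h x) (h' x)) (solve 5 (λ x a b c d → (x :* a :+ c) :+ (x :* b :+ d) := x :* (a :+ b) :+ (c :+ d)) refl x (f1 x) (g1 x) c c'))

  Le-scale : ∀ {d f} a → Le d f → Le d (λ x → a * f x)
  Le-scale a (le0 c f h) = le0 (a * c) _ (λ x → cong (a *_) (h x))
  Le-scale a (leS g c f l h) = leS _ (a * c) _ (Le-scale a l)
    (λ x → trans (cong (a *_) (h x)) (solve 4 (λ a x g c → a :* (x :* g :+ c) := x :* (a :* g) :+ a :* c) refl a x (g x) c))

  Le-neg : ∀ {d f} → Le d f → Le d (λ x → - f x)
  Le-neg {f = f} l = Le-ext (Le-scale (- 1#) l) (λ x → trans (cong -_ (sym (*-identityˡ (f x)))) (-‿distribˡ-* 1# (f x)))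

  Le-wk : ∀ {d f} → Le d f → Le (suc d) f
  Le-wk (le0 c f h) = leS (λ _ → 0#) c f (Le-const 0#) (λ x → trans (h x) (sym (trans (cong (_+ c) (zeroʳ x)) (+-identityˡ c))))
  Le-wk (leS g c f l h) = leS g c f (Le-wk l) h

  Le-wk≤ : ∀ {d d' f} → d ≤ d' → Le d f → Le d' f
  Le-wk≤ {d} {d'} le l with NP.m≤n⇒∃[o]m+o≡n le
  ... | (o , refl) = go o l
    where
    go : ∀ o {f} → Le d f → Le (d ℕ.+ o) f
    go zero {f} l = subst (λ z → Le z f) (sym (NP.+-identityʳ d)) l
    go (suc o) {f} l = subst (λ z → Le z f) (sym (NP.+-suc d o)) (Le-wk (go o l))

  Poly⇒Le : ∀ {d f} → Poly d f → Le d f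
  Poly⇒Le (p0 c f _ h) = le0 c f h
  Poly⇒Le (pS g c f l h) = leS g c f (Poly⇒Le l) h

  Poly-add : ∀ {e g k} → Poly (suc e) g → Le e k → Poly (suc e) (λ x → g x + k x)
  Poly-add (pS g1 c g pg h) (le0 c' k h') = pS g1 (c + c') _ pg
    (λ x → trans (cong₂ _+_ (h x) (h' x)) (+-assoc _ _ _))
  Poly-add (pS g1 c g pg h) (leS k1 c' k l h') = pS _ (c + c') _ (Poly-add pg l)
    (λ x → trans (cong₂ _+_ (h x) (h' x)) (solve 5 (λ x a b c d → (x :* a :+ c) :+ (x :* b :+ d) := x :* (a :+ b) :+ (c :+ d)) refl x (g1 x) (k1 x) c c'))

  Poly-addLow : ∀ {d e g k} → Poly d g → Le e k → e < d → Poly d (λ x → g x + k x)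
  Poly-addLow {suc d} pg lk (s≤s le) = Poly-add pg (Le-wk≤ le lk)

  Poly-pow : ∀ d → Poly d (λ x → x ^ d)
  Poly-pow zero = p0 1# _ 1≢0 (λ _ → refl)
  Poly-pow (suc d) = pS _ 0# _ (Poly-pow d) (λ x → sym (+-identityʳ _))

  factor : ∀ {d f} → Poly (suc d) f → ∀ a → Σ[ h ∈ Fn ] (Poly d h × (∀ x → f x ≡ f a + (x + - a) * h x))
  factor (pS g c f (p0 c0 g c0≢0 hg) hf) a = (λ _ → c0) , p0 c0 _ c0≢0 (λ _ → refl) , λ x → begin
    f x                              ≡⟨ hf x ⟩
    x * g x + c                      ≡⟨ cong (λ z → x * z + c) (hg x) ⟩
    x * c0 + c                       ≡⟨ solve 4 (λ x a c0 c → x :* c0 :+ c := (a :* c0 :+ c) :+ (x :- a) :* c0) refl x a c0 c ⟩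
    (a * c0 + c) + (x + - a) * c0    ≡⟨ cong (λ z → (a * z + c) + (x + - a) * c0) (sym (hg a)) ⟩
    (a * g a + c) + (x + - a) * c0   ≡⟨ cong (_+ (x + - a) * c0) (sym (hf a)) ⟩
    f a + (x + - a) * c0             ∎
  factor (pS g c f pg@(pS _ _ _ _ _) hf) a with factor pg a
  ... | (k , pk , hk) = (λ x → g x + a * k x) , Poly-add pg (Le-scale a (Poly⇒Le pk)) , λ x → begin
    f x
      ≡⟨ hf x ⟩
    x * g x + c
      ≡⟨ solve 5 (λ x a gx ga c → x :* gx :+ c := (a :* ga :+ c) :+ (x :- a) :* gx :+ a :* (gx :- ga)) refl x a (g x) (g a) c ⟩
    (a * g a + c) + (x + - a) * g x + a * (g x + - g a)
      ≡⟨ cong (λ z → (a * g a + c) + (x + - a) * g x + a * z) (g-difference x) ⟩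
    (a * g a + c) + (x + - a) * g x + a * ((x + - a) * k x)
      ≡⟨ solve 5 (λ A xa gx a k → A :+ xa :* gx :+ a :* (xa :* k) := A :+ xa :* (gx :+ a :* k)) refl (a * g a + c) (x + - a) (g x) a (k x) ⟩
    (a * g a + c) + (x + - a) * (g x + a * k x)
      ≡⟨ cong (_+ (x + - a) * (g x + a * k x)) (sym (hf a)) ⟩
    f a + (x + - a) * (g x + a * k x)
      ∎
    where
    g-difference : ∀ x → g x + - g a ≡ (x + - a) * k x
    g-difference x = trans (cong (_+ - g a) (hk x)) (solve 3 (λ ga xa k → (ga :+ xa :* k) :- ga := xa :* k) refl (g a) (x + - a) (k x))

  roots : ∀ {d f} → Poly d f → ∀ xs → Unique xs → (∀ x → x ∈ xs → f x ≡ 0#) → length xs ≤ d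
  roots pf [] u h = z≤n
  roots (p0 c f c0 hf) (x ∷ xs) u h = ⊥-elim (c0 (trans (sym (hf x)) (h x (here refl))))
  roots {suc d} {f} pf (a ∷ xs) (a∉ ∷ u) h with factor pf a
  ... | (k , pk , hk) = s≤s (roots pk xs u (λ y y∈ → kz y y∈))
    where
    kz : ∀ y → y ∈ xs → k y ≡ 0#
    kz y y∈ with intdom (y + - a) (k y) (trans (sym (+-identityˡ _)) (trans (cong (_+ _) (sym (h a (here refl)))) (trans (sym (hk y)) (h y (there y∈)))))
    ... | inj₂ e = e
    ... | inj₁ e = ⊥-elim (All.lookup a∉ y∈ (sym (x-y≡0⇒x≡y y a e)))

  roots-count : ∀ {d f} → Poly d f → ∀ xs → Unique xs → ℕSum.count (λ x → f x ≟ 0#) xs ≤ d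
  roots-count {d} {f} pf xs u = subst (_≤ d) (ℕSum.length-filter root? xs)
    (roots pf (filter root? xs) (UP.filter⁺ root? u) (λ x m → proj₂ (MP.∈-filter⁻ root? {xs = xs} m)))
    where
    root? = λ x → f x ≟ 0#

-- The proof is a
-- squeeze: Tr - w has degree b^m (so fibres have ≤ b^m elements), x^b - x has
-- degree b (so |F_b| ≤ b), and the fibres add up to b^{m+1}.
module TraceFibres (L : FiniteField) where
  open ListSums
  open Additivity L public
  open Polynomials L public
  open ≡-Reasoning

  Sub : ℕ → List Carrier
  Sub m = filter (λ x → (x ^ m) ≟ x) E

  Sub-unique : ∀ m → Unique (Sub m)
  Sub-unique m = UP.filter⁺ (λ x → (x ^ m) ≟ x) unique

  Sub-∈ : ∀ {m x} → x ^ m ≡ x → x ∈ Sub m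
  Sub-∈ {m} {x} e = MP.∈-filter⁺ (λ x → (x ^ m) ≟ x) (complete x) e

  Sub-eq : ∀ {m x} → x ∈ Sub m → x ^ m ≡ x
  Sub-eq {m} m∈ = proj₂ (MP.∈-filter⁻ (λ x → (x ^ m) ≟ x) {xs = E} m∈)

  SU-unique : ∀ m → Unique (subUnits m)
  SU-unique m = UP.filter⁺ (λ x → ¬? (x ≟ 0#) ×-dec ((x ^ m) ≟ x)) unique

  SU-∈ : ∀ {m x} → x ≢ 0# → x ^ m ≡ x → x ∈ subUnits m
  SU-∈ {m} {x} a b = MP.∈-filter⁺ (λ x → ¬? (x ≟ 0#) ×-dec ((x ^ m) ≟ x)) (complete x) (a , b)

  SU-prop : ∀ {m x} → x ∈ subUnits m → (x ≢ 0#) × (x ^ m ≡ x)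
  SU-prop {m} mem = proj₂ (MP.∈-filter⁻ (λ x → ¬? (x ≟ 0#) ×-dec ((x ^ m) ≟ x)) {xs = E} mem)

  Sub-split : ∀ m (h : Carrier → ℕ) → 0# ^ m ≡ 0# → ℕSum.Σ (Sub m) h ≡ h 0# ℕ.+ ℕSum.Σ (subUnits m) h
  Sub-split m h z0 = ℕSum.Reindex.Σ-perm _≟_ (Sub m) (0# ∷ subUnits m) h (Sub-unique m)
      (All.tabulate (λ mem e → proj₁ (SU-prop {m} mem) (sym e)) ∷ SU-unique m) to fro
    where
    to : ∀ {x} → x ∈ Sub m → x ∈ (0# ∷ subUnits m)
    to {x} mem with x ≟ 0#
    ... | yes e = here e
    ... | no ne = there (SU-∈ {m} ne (Sub-eq {m} mem))
    fro : ∀ {x} → x ∈ (0# ∷ subUnits m) → x ∈ Sub m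
    fro (here refl) = Sub-∈ {m} z0
    fro (there mem) = Sub-∈ {m} (proj₂ (SU-prop {m} mem))

  |units|+1 : ∀ m → 0# ^ m ≡ 0# → length (Sub m) ≡ 1 ℕ.+ length (subUnits m)
  |units|+1 m z0 = trans (sym (ℕSum.Σ-one (Sub m))) (trans (Sub-split m (λ _ → 1) z0) (cong suc (ℕSum.Σ-one (subUnits m))))

  Le-sum : ∀ D m (f : ℕ → Carrier → Carrier) → (∀ i → i < m → Le D (f i)) → Le D (λ x → sumUpTo m (λ i → f i x))
  Le-sum D zero f h = Le-wk≤ z≤n (Le-const 0#)
  Le-sum D (suc m) f h = Le-add (Le-sum D m f (λ i lt → h i (NP.m≤n⇒m≤1+n lt))) (h m NP.≤-refl)

  Le-pow : ∀ {k D} → k ≤ D → Le D (λ x → x ^ k)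
  Le-pow {k} le = Le-wk≤ le (Poly⇒Le (Poly-pow k))

  -- Tr_b^{m+1}(x) - c has degree b^m: its leading term is x^{b^m}
  Poly-Tr : ∀ b m c → 1 < b → Poly (b ℕ.^ m) (λ x → Tr b (suc m) x + - c)
  Poly-Tr b m c b>1 =
    Poly-ext (Poly-addLow (Poly-pow (b ℕ.^ m)) (Le-add lower (Le-wk≤ z≤n (Le-const (- c)))) D<b^m)
      (λ x → solve 3 (λ s t c → (s :+ t) :- c := t :+ (s :- c)) refl (sumUpTo m (λ i → x ^ (b ℕ.^ i))) (x ^ (b ℕ.^ m)) c)
    where
    D = b ℕ.^ m ℕ.∸ 1
    D<b^m : D < b ℕ.^ m
    D<b^m = NP.m≤pred[n]⇒suc[m]≤n {{ℕ.>-nonZero (NP.m^n>0 b {{ℕ.>-nonZero (NP.<-trans (s≤s z≤n) b>1)}} m)}} NP.≤-refl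
    lower : Le D (λ x → sumUpTo m (λ i → x ^ (b ℕ.^ i)))
    lower = Le-sum D m (λ i x → x ^ (b ℕ.^ i)) (λ i i<m → Le-pow (NP.<⇒≤pred (NP.^-monoʳ-< b b>1 i<m)))

  Poly-AS : ∀ b c → 1 < b → Poly b (λ x → x ^ b + (- x + - c))
  Poly-AS b c b>1 = Poly-addLow (Poly-pow b)
    (Le-add (Le-ext (Le-neg (Le-pow {1} {1} NP.≤-refl)) (λ x → cong -_ (sym (*-identityʳ x)))) (Le-wk≤ z≤n (Le-const (- c))))
    b>1

  count-Tr-≤ : ∀ b m w xs → 1 < b → Unique xs → ℕSum.count (λ x → Tr b (suc m) x ≟ w) xs ≤ b ℕ.^ m
  count-Tr-≤ b m w xs b>1 u = NP.≤-trans
    (NP.≤-reflexive (ℕSum.count-cong (λ x → Tr b (suc m) x ≟ w) (λ x → (Tr b (suc m) x + - w) ≟ 0#) xs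
      (λ x _ e → x≡y⇒x-y≡0 _ _ e) (λ x _ e → x-y≡0⇒x≡y _ _ e)))
    (roots-count (Poly-Tr b m w b>1) xs u)

  Sub-len-≤ : ∀ b → 1 < b → length (Sub b) ≤ b
  Sub-len-≤ b b>1 = NP.≤-trans (NP.≤-reflexive (trans (ℕSum.length-filter (λ x → (x ^ b) ≟ x) E) same))
                               (roots-count (Poly-AS b 0# b>1) E unique)
    where
    simplify : ∀ x → x ^ b + (- x + - 0#) ≡ x ^ b + - x
    simplify x = trans (cong (λ z → x ^ b + (- x + z)) -0#≈0#) (cong (x ^ b +_) (+-identityʳ _))
    same : ℕSum.count (λ x → (x ^ b) ≟ x) E ≡ ℕSum.count (λ x → (x ^ b + (- x + - 0#)) ≟ 0#) E
    same = ℕSum.count-cong (λ x → (x ^ b) ≟ x) (λ x → (x ^ b + (- x + - 0#)) ≟ 0#) E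
      (λ x _ e → trans (simplify x) (x≡y⇒x-y≡0 _ _ e))
      (λ x _ e → x-y≡0⇒x≡y _ _ (trans (sym (simplify x)) e))

  Tr-Sub : ∀ b m x → 1 < b → Additive b → x ^ (b ℕ.^ suc m) ≡ x → Tr b (suc m) x ^ b ≡ Tr b (suc m) x
  Tr-Sub b m x b>1 fb hx = begin
    Tr b (suc m) x ^ b                          ≡⟨ Additive-sum b (NP.<-trans (s≤s z≤n) b>1) fb (suc m) g ⟩
    sumUpTo (suc m) (λ i → g i ^ b)             ≡⟨ range-cong (suc m) _ _ (λ i _ → trans (sym (^-* x (b ℕ.^ i) b)) (cong (x ^_) (NP.*-comm (b ℕ.^ i) b))) ⟩
    sumUpTo m (λ i → g (suc i)) + g (suc m)     ≡⟨ cong (sumUpTo m (λ i → g (suc i)) +_) (trans hx (sym (*-identityʳ x))) ⟩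
    sumUpTo m (λ i → g (suc i)) + g 0           ≡⟨ +-comm _ _ ⟩
    g 0 + sumUpTo m (λ i → g (suc i))           ≡⟨ sym (range-shift m g) ⟩
    Tr b (suc m) x                              ∎
    where
    g : ℕ → Carrier
    g i = x ^ (b ℕ.^ i)

  record TraceEquidistributed (b m : ℕ) (U : List Carrier) : Set where
    field
      |Sub| : length (Sub b) ≡ b
      fibre : ∀ w → w ∈ Sub b → ℕSum.count (λ x → Tr b (suc m) x ≟ w) U ≡ b ℕ.^ m

  trace-equidistributed : ∀ b m U → 1 < b → Additive b → Unique U → length U ≡ b ℕ.^ suc m →
    (∀ x → x ∈ U → x ^ (b ℕ.^ suc m) ≡ x) → TraceEquidistributed b m U
  trace-equidistributed b m U b>1 fb uU |U| fixed = record { |Sub| = proj₁ squeezed ; fibre = proj₂ squeezed }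
    where
    module D = ℕSum.Fibres _≟_
    T : Carrier → Carrier
    T = Tr b (suc m)
    fibre-size : Carrier → ℕ
    fibre-size w = ℕSum.count (λ x → T x ≟ w) U
    T∈Sub : ∀ x → x ∈ U → T x ∈ Sub b
    T∈Sub x x∈ = Sub-∈ {b} (Tr-Sub b m x b>1 fb (fixed x x∈))
    total : ℕSum.Σ (Sub b) fibre-size ≡ b ℕ.* b ℕ.^ m
    total = begin
      ℕSum.Σ (Sub b) fibre-size                                ≡⟨ ℕSum.Σ-cong (Sub b) (λ w _ → ℕSum.Σ-cong U (λ x _ → sym (D.sel-ind (T x) w))) ⟩
      ℕSum.Σ (Sub b) (λ w → ℕSum.Σ U (λ x → D.sel (T x) w 1))   ≡⟨ sym (D.fibre-sum U (Sub b) T (λ _ → 1) (Sub-unique b) T∈Sub) ⟩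
      ℕSum.Σ U (λ _ → 1)                                       ≡⟨ ℕSum.Σ-one U ⟩
      length U                                                 ≡⟨ |U| ⟩
      b ℕ.* b ℕ.^ m                                            ∎
    squeezed = ℕSum.squeeze (Sub b) fibre-size (b ℕ.^ m) b (NP.m^n>0 b {{ℕ.>-nonZero (NP.<-trans (s≤s z≤n) b>1)}} m) total
                 (λ w _ → count-Tr-≤ b m w U b>1 uU) (Sub-len-≤ b b>1)

-- The point (0:0:1) is never on the curve and
-- (0:1:z) only for z = 0; on x = 1, the line z = 0 contributes only y = 0, and
-- for z ≠ 0 the substitution y = t·z turns the equation into the
-- Artin–Schreier equation t^p - t = β(α/z - z).
module CurvePoints (L : FiniteField) where
  open ListSums
  open FieldOrder L
  open ≡-Reasoning

  module D = ℕSum.Fibres _≟_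

  AS : ℕ → Carrier → ℕ
  AS P c = ℕSum.count (λ t → (t ^ P + - t) ≟ c) E

  chart-inner : ∀ (g : Carrier × Carrier × Carrier → ℕ) y zs acc →
    ℕSum.Σ (foldr (λ z acc' → (1# , y , z) ∷ acc') acc zs) g ≡ ℕSum.Σ zs (λ z → g (1# , y , z)) ℕ.+ ℕSum.Σ acc g
  chart-inner g y [] acc = refl
  chart-inner g y (z ∷ zs) acc =
    trans (cong (g (1# , y , z) ℕ.+_) (chart-inner g y zs acc))
          (sym (NP.+-assoc (g (1# , y , z)) (ℕSum.Σ zs (λ z → g (1# , y , z))) (ℕSum.Σ acc g)))

  chart : ∀ (g : Carrier × Carrier × Carrier → ℕ) ys →
    ℕSum.Σ (foldr (λ y acc → foldr (λ z acc' → (1# , y , z) ∷ acc') acc E) [] ys) g ≡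
    ℕSum.Σ ys (λ y → ℕSum.Σ E (λ z → g (1# , y , z)))
  chart g [] = refl
  chart g (y ∷ ys) = trans (chart-inner g y E _) (cong (ℕSum.Σ E (λ z → g (1# , y , z)) ℕ.+_) (chart g ys))

  module Count (k : ℕ) (α β : Carrier) where
    P = suc (suc k)
    cp = curvePoly P α β

    -- the curve polynomial at the four kinds of normalised points
    -- (for z ≠ 0 and y = t·z it factors as z^{p+1}·(t^p - t - β(α/z - z)))
    cpA : cp (0# , 0# , 1#) ≡ β
    cpA = begin
      (0# * 0# ^ P + - (0# * 0# * 1# ^ suc k)) + - (β * (α * 0# ^ 2 * 1# ^ suc k + - 1# ^ (P ℕ.+ 1)))
        ≡⟨ cong₂ (λ u v → (0# * 0# ^ P + - (0# * 0# * u)) + - (β * (α * 0# ^ 2 * u + - v))) (1^ (suc k)) (1^ (P ℕ.+ 1)) ⟩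
      (0# * 0# ^ P + - (0# * 0# * 1#)) + - (β * (α * 0# ^ 2 * 1# + - 1#))
        ≡⟨ solve 3 (λ a b c → (𝟎 :* a :+ :- (𝟎 :* 𝟎 :* 𝟏)) :+ :- (b :* (c :* (𝟎 :* (𝟎 :* 𝟏)) :* 𝟏 :+ :- 𝟏)) := b)
                   refl (0# ^ P) β α ⟩
      β ∎

    cpB : ∀ z → cp (0# , 1# , z) ≡ β * z ^ (P ℕ.+ 1)
    cpB z = solve 5 (λ a b d β α → (𝟎 :* a :+ :- (𝟎 :* 𝟏 :* b)) :+ :- (β :* (α :* (𝟎 :* (𝟎 :* 𝟏)) :* b :+ :- d)) := β :* d)
                    refl (1# ^ P) (z ^ suc k) (z ^ (P ℕ.+ 1)) β α

    cpC : ∀ y → cp (1# , y , 0#) ≡ y ^ P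
    cpC y = solve 6 (λ a y u v α β → (𝟏 :* a :+ :- (𝟏 :* y :* (𝟎 :* u))) :+ :- (β :* (α :* (𝟏 :* (𝟏 :* 𝟏)) :* (𝟎 :* u) :+ :- (𝟎 :* v))) := a)
                    refl (y ^ P) y (0# ^ k) (0# ^ suc (k ℕ.+ 1)) α β

    cpD : ∀ t z → z ≢ 0# → cp (1# , t * z , z) ≡ (z ^ suc k * z) * ((t ^ P + - t) + - (β * (α * inv z + - z)))
    cpD t z z≢0 = begin
      cp (1# , t * z , z)
        ≡⟨ cong₂ (λ a b → (1# * a + - (1# * (t * z) * (z * z ^ k))) + - (β * (α * (1# * (1# * 1#)) * (z * z ^ k) + - (z * (z * b)))))
                 (*-^ t z P) (^-+ z k 1) ⟩
      (1# * (t ^ P * (z * (z * z ^ k))) + - (1# * (t * z) * (z * z ^ k)))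
        + - (β * (α * (1# * (1# * 1#)) * (z * z ^ k) + - (z * (z * (z ^ k * (z * 1#))))))
        ≡⟨ solve 7 (λ T t z Zk β α i →
             (𝟏 :* (T :* (z :* (z :* Zk))) :+ :- (𝟏 :* (t :* z) :* (z :* Zk)))
               :+ :- (β :* (α :* (𝟏 :* (𝟏 :* 𝟏)) :* (z :* Zk) :+ :- (z :* (z :* (Zk :* (z :* 𝟏))))))
             := ((z :* Zk) :* z) :* ((T :- t) :- (β :* (α :* i :- z))) :+ (z :* Zk :* β :* α) :* (z :* i :- 𝟏))
             refl (t ^ P) t z (z ^ k) β α (inv z) ⟩
      RHS + (z * z ^ k * β * α) * (z * inv z + - 1#)
        ≡⟨ cong (λ w → RHS + (z * z ^ k * β * α) * w) (x≡y⇒x-y≡0 _ _ (inv-r z z≢0)) ⟩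
      RHS + (z * z ^ k * β * α) * 0#
        ≡⟨ trans (cong (RHS +_) (zeroʳ _)) (+-identityʳ RHS) ⟩
      RHS ∎
      where
      RHS = (z ^ suc k * z) * ((t ^ P + - t) + - (β * (α * inv z + - z)))

    onCurve : Carrier × Carrier × Carrier → ℕ
    onCurve x = ℕSum.ind (cp x ≟ 0#)

    by-charts : curveCount P α β ≡
      ℕSum.Σ E (λ y → ℕSum.Σ E (λ z → onCurve (1# , y , z))) ℕ.+ (ℕSum.Σ E (λ z → onCurve (0# , 1# , z)) ℕ.+ (onCurve (0# , 0# , 1#) ℕ.+ 0))
    by-charts = begin
      curveCount P α β  ≡⟨ ℕSum.length-filter (λ x → cp x ≟ 0#) P2 ⟩
      ℕSum.Σ P2 onCurve ≡⟨ ℕSum.Σ-++ (foldr (λ y acc → foldr (λ z acc' → (1# , y , z) ∷ acc') acc E) [] E) _ onCurve ⟩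
      _                 ≡⟨ cong₂ ℕ._+_ (chart onCurve E)
                             (trans (ℕSum.Σ-++ (map (λ z → (0# , 1# , z)) E) _ onCurve)
                                    (cong (ℕ._+ (onCurve (0# , 0# , 1#) ℕ.+ 0)) (ℕSum.Σ-map (λ z → (0# , 1# , z)) E onCurve))) ⟩
      _                 ∎

    module _ (β≢0 : β ≢ 0#) where
      at-001 : onCurve (0# , 0# , 1#) ≡ 0
      at-001 with cp (0# , 0# , 1#) ≟ 0#
      ... | yes e = ⊥-elim (β≢0 (trans (sym cpA) e))
      ... | no _ = refl

      line-x=0 : ℕSum.Σ E (λ z → onCurve (0# , 1# , z)) ≡ 1
      line-x=0 = trans
        (ℕSum.count-cong (λ z → cp (0# , 1# , z) ≟ 0#) (λ z → z ≟ 0#) E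
          (λ z _ e → case intdom β _ (trans (sym (cpB z)) e) of λ
            { (inj₁ b) → ⊥-elim (β≢0 b) ; (inj₂ w) → ^≡0 z (P ℕ.+ 1) w })
          (λ z _ e → trans (cpB z) (trans (cong (λ w → β * w ^ (P ℕ.+ 1)) e) (trans (cong (β *_) (0^ (suc (k ℕ.+ 1)))) (zeroʳ β)))))
        (ℕSum.Fibres.count-eq _≟_ E 0# unique (complete 0#))

      line-z=0 : ℕSum.Σ E (λ y → onCurve (1# , y , 0#)) ≡ 1
      line-z=0 = trans
        (ℕSum.count-cong (λ y → cp (1# , y , 0#) ≟ 0#) (λ y → y ≟ 0#) E
          (λ y _ e → ^≡0 y P (trans (sym (cpC y)) e))
          (λ y _ e → trans (cpC y) (trans (cong (_^ P) e) (0^ (suc k)))))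
        (ℕSum.Fibres.count-eq _≟_ E 0# unique (complete 0#))

      -- on the line z (≠ 0), the substitution y = t·z gives t^P - t = β(α/z - z)
      line-z : ∀ z → z ≢ 0# → ℕSum.Σ E (λ y → onCurve (1# , y , z)) ≡ AS P (β * (α * inv z + - z))
      line-z z z≢0 = trans
        (sym (D.Σ-bij E E (λ t → t * z) (λ y → y * inv z) (λ y → onCurve (1# , y , z)) unique unique
          (λ _ → complete _) (λ _ → complete _)
          (λ {t} _ → trans (*-assoc _ _ _) (trans (cong (t *_) (inv-r z z≢0)) (*-identityʳ t)))
          (λ {y} _ → trans (*-assoc _ _ _) (trans (cong (y *_) (trans (*-comm _ _) (inv-r z z≢0))) (*-identityʳ y)))))
        (ℕSum.count-cong (λ t → cp (1# , t * z , z) ≟ 0#) (λ t → (t ^ P + - t) ≟ c) E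
          (λ t _ e → x-y≡0⇒x≡y _ _ (case intdom _ _ (trans (sym (cpD t z z≢0)) e) of λ
            { (inj₁ w) → ⊥-elim (*≢0 (^≢0 z (suc k) z≢0) z≢0 w) ; (inj₂ w) → w }))
          (λ t _ e → trans (cpD t z z≢0) (trans (cong ((z ^ suc k * z) *_) (x≡y⇒x-y≡0 _ _ e)) (zeroʳ _))))
        where c = β * (α * inv z + - z)

      curve-count : curveCount P α β ≡ 2 ℕ.+ ℕSum.Σ NZ (λ z → AS P (β * (α * inv z + - z)))
      curve-count = begin
        curveCount P α β
          ≡⟨ by-charts ⟩
        ℕSum.Σ E (λ y → ℕSum.Σ E (λ z → onCurve (1# , y , z))) ℕ.+ (ℕSum.Σ E (λ z → onCurve (0# , 1# , z)) ℕ.+ (onCurve (0# , 0# , 1#) ℕ.+ 0))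
          ≡⟨ cong₂ (λ a b → a ℕ.+ (b ℕ.+ (onCurve (0# , 0# , 1#) ℕ.+ 0))) (ℕSum.Σ-swap E E (λ y z → onCurve (1# , y , z))) line-x=0 ⟩
        ℕSum.Σ E (λ z → row z) ℕ.+ (1 ℕ.+ (onCurve (0# , 0# , 1#) ℕ.+ 0))
          ≡⟨ cong₂ (λ a b → a ℕ.+ (1 ℕ.+ (b ℕ.+ 0))) (Σ-zero-split row) at-001 ⟩
        (row 0# ℕ.+ ℕSum.Σ NZ row) ℕ.+ 1
          ≡⟨ cong₂ (λ a b → (a ℕ.+ b) ℕ.+ 1) line-z=0 (ℕSum.Σ-cong NZ (λ z m → line-z z (NZ-≢ m))) ⟩
        (1 ℕ.+ ℕSum.Σ NZ (λ z → AS P (β * (α * inv z + - z)))) ℕ.+ 1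
          ≡⟨ NP.+-comm _ 1 ⟩
        2 ℕ.+ ℕSum.Σ NZ (λ z → AS P (β * (α * inv z + - z))) ∎
        where
        row : Carrier → ℕ
        row z = ℕSum.Σ E (λ y → onCurve (1# , y , z))

module PrimeSubfield (L : FiniteField) (p m : ℕ) (pp : Prime p)
                     (|L| : FiniteField.card L ≡ p ℕ.^ suc m) where
  open ListSums
  open TraceFibres L public
  open ≡-Reasoning

  p>1 : 1 < p
  p>1 = prime>1 pp

  p>0 : 0 < p
  p>0 = NP.<-trans (s≤s z≤n) p>1

  p^>0 : ∀ k → 0 < p ℕ.^ k
  p^>0 k = NP.m^n>0 p {{ℕ.>-nonZero p>0}} k

  char-p : nat p ≡ 0#
  char-p = ^≡0 (nat p) (suc m) (begin
    nat p ^ suc m        ≡⟨ sym (nat-^ p (suc m)) ⟩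
    nat (p ℕ.^ suc m)    ≡⟨ cong nat (sym |L|) ⟩
    nat N                ≡⟨ trans (sym (*-identityʳ _)) (N·x≡0 1#) ⟩
    0#                   ∎)

  frob-p : Additive p
  frob-p = frobenius p pp char-p

  additive-p^ : ∀ k → Additive (p ℕ.^ k)
  additive-p^ = Additive-^ p frob-p

  module Sp = FixedField p p>0 frob-p

  Fp : List Carrier
  Fp = Sub p

  TrL : Carrier → Carrier
  TrL = Tr p (suc m)

  x^|L| : ∀ x → x ^ (p ℕ.^ suc m) ≡ x
  x^|L| x = subst (λ k → x ^ k ≡ x) |L| (x^N≡x x)

  L/Fp : TraceEquidistributed p m E
  L/Fp = trace-equidistributed p m E p>1 frob-p unique |L| (λ x _ → x^|L| x)

  |Fp| : length Fp ≡ p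
  |Fp| = TraceEquidistributed.|Sub| L/Fp

  fib-L : ∀ w → w ∈ Fp → ℕSum.count (λ x → TrL x ≟ w) E ≡ p ℕ.^ m
  fib-L = TraceEquidistributed.fibre L/Fp

-- Each nonempty fibre of the additive map
-- ℘ is a coset of its kernel F_p, the image of ℘ lies in ker Tr, and both
-- Σ_c #℘⁻¹(c) and Σ_c p·[Tr c = 0] equal |L|, which forces equality.
module ArtinSchreier (L : FiniteField) (p m : ℕ) (pp : Prime p)
                     (|L| : FiniteField.card L ≡ p ℕ.^ suc m) where
  open ListSums
  open CurvePoints L using (AS)
  import Data.List.Relation.Unary.Any as Any
  open PrimeSubfield L p m pp |L| public
  open ≡-Reasoning

  ℘ : Carrier → Carrier
  ℘ t = t ^ p + - t

  A : Carrier → ℕ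
  A = AS p

  ℘-+ : ∀ t s → ℘ (t + s) ≡ ℘ t + ℘ s
  ℘-+ t s = trans (cong (_+ - (t + s)) (frob-p t s))
                  (solve 4 (λ a b t s → (a :+ b) :- (t :+ s) := (a :- t) :+ (b :- s)) refl _ _ t s)

  ℘-Fp : ∀ s → s ^ p ≡ s → ℘ s ≡ 0#
  ℘-Fp s hs = x≡y⇒x-y≡0 _ _ hs

  Sol : Carrier → List Carrier
  Sol c = filter (λ t → ℘ t ≟ c) E

  -- if ℘(t₀) = c then the solutions are exactly t₀ + F_p
  A-sol : ∀ c t₀ → ℘ t₀ ≡ c → A c ≡ p
  A-sol c t₀ h₀ = begin
    A c                       ≡⟨ sym (ℕSum.length-filter (λ t → ℘ t ≟ c) E) ⟩
    length (Sol c)            ≡⟨ sym (ℕSum.Σ-one (Sol c)) ⟩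
    ℕSum.Σ (Sol c) (λ _ → 1)  ≡⟨ sym (ℕSum.Reindex.Σ-bij _≟_ Fp (Sol c) (λ s → t₀ + s) (λ t → t + - t₀) (λ _ → 1)
                                    (Sub-unique p) (UP.filter⁺ (λ t → ℘ t ≟ c) unique) shift∈ unshift∈
                                    (λ {s} _ → solve 2 (λ t s → (t :+ s) :- t := s) refl t₀ s)
                                    (λ {t} _ → solve 2 (λ t₀ t → t₀ :+ (t :- t₀) := t) refl t₀ t)) ⟩
    ℕSum.Σ Fp (λ _ → 1)       ≡⟨ trans (ℕSum.Σ-one Fp) |Fp| ⟩
    p                         ∎
    where
    shift∈ : ∀ {s} → s ∈ Fp → t₀ + s ∈ Sol c
    shift∈ {s} m = MP.∈-filter⁺ (λ t → ℘ t ≟ c) (complete _)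
      (trans (℘-+ t₀ s) (trans (cong₂ _+_ h₀ (℘-Fp s (Sub-eq {p} m))) (+-identityʳ c)))
    unshift∈ : ∀ {t} → t ∈ Sol c → t + - t₀ ∈ Fp
    unshift∈ {t} m = Sub-∈ {p} (begin
      (t + - t₀) ^ p                 ≡⟨ frob-p t (- t₀) ⟩
      t ^ p + (- t₀) ^ p             ≡⟨ cong (t ^ p +_) (Additive-neg p p>0 frob-p t₀) ⟩
      t ^ p + - (t₀ ^ p)             ≡⟨ solve 4 (λ a b t t₀ → a :- b := (t :- t₀) :+ ((a :- t) :- (b :- t₀))) refl (t ^ p) (t₀ ^ p) t t₀ ⟩
      (t + - t₀) + (℘ t + - ℘ t₀)    ≡⟨ cong₂ (λ u v → (t + - t₀) + (u + - v)) ht h₀ ⟩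
      (t + - t₀) + (c + - c)         ≡⟨ trans (cong ((t + - t₀) +_) (-‿inverseʳ c)) (+-identityʳ _) ⟩
      t + - t₀                       ∎)
      where
      ht : ℘ t ≡ c
      ht = proj₂ (MP.∈-filter⁻ (λ t → ℘ t ≟ c) {xs = E} m)

  A-cases : ∀ c → (A c ≡ 0) ⊎ (Σ[ t ∈ Carrier ] ℘ t ≡ c)
  A-cases c with Any.any? (λ t → ℘ t ≟ c) E
  ... | yes a = inj₂ (Any.satisfied a)
  ... | no na = inj₁ (ℕSum.count-none (λ t → ℘ t ≟ c) E (λ t _ e → na (Any.map (λ { refl → e }) (complete t))))

  A≤p : ∀ c → A c ≤ p
  A≤p c with A-cases c
  ... | inj₁ e = NP.≤-trans (NP.≤-reflexive e) z≤n
  ... | inj₂ (t , h) = NP.≤-reflexive (A-sol c t h)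

  telescope : ∀ k (g : ℕ → Carrier) → sumUpTo k (λ i → g (suc i) + - g i) ≡ g k + - g 0
  telescope zero g = sym (-‿inverseʳ (g 0))
  telescope (suc k) g = trans (cong (_+ (g (suc k) + - g k)) (telescope k g))
    (solve 3 (λ a b c → (b :- a) :+ (c :- b) := c :- a) refl (g 0) (g k) (g (suc k)))

  -- the image of ℘ lies in the kernel of the trace: Tr(t^p - t) telescopes
  Tr-℘ : ∀ t → TrL (℘ t) ≡ 0#
  Tr-℘ t = begin
    sumUpTo (suc m) (λ i → (t ^ p + - t) ^ (p ℕ.^ i))  ≡⟨ range-cong (suc m) _ _ (λ i _ → term i) ⟩
    sumUpTo (suc m) (λ i → g (suc i) + - g i)          ≡⟨ telescope (suc m) g ⟩
    g (suc m) + - g 0                                  ≡⟨ cong₂ (λ a b → a + - b) (x^|L| t) (*-identityʳ t) ⟩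
    t + - t                                            ≡⟨ -‿inverseʳ t ⟩
    0#                                                 ∎
    where
    g : ℕ → Carrier
    g i = t ^ (p ℕ.^ i)
    term : ∀ i → (t ^ p + - t) ^ (p ℕ.^ i) ≡ g (suc i) + - g i
    term i = trans (additive-p^ i (t ^ p) (- t))
      (cong₂ _+_ (sym (^-* t p (p ℕ.^ i))) (Additive-neg (p ℕ.^ i) (p^>0 i) (additive-p^ i) t))

  A-formula : ∀ c → A c ≡ p ℕ.* ℕSum.ind (TrL c ≟ 0#)
  A-formula c = trans (sym (I·A≡A c)) (ℕSum.Σ-eq-pointwise E f g f≤g (trans (ℕSum.Σ-cong E (λ c _ → I·A≡A c)) (trans ΣA≡N (sym Σg≡N))) c (complete c))
    where
    I : Carrier → ℕ
    I c = ℕSum.ind (TrL c ≟ 0#)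
    f g : Carrier → ℕ
    f c = I c ℕ.* A c
    g c = p ℕ.* I c
    I·A≡A : ∀ c → f c ≡ A c
    I·A≡A c with TrL c ≟ 0# | A-cases c
    ... | yes _ | _ = NP.+-identityʳ _
    ... | no _ | inj₁ e = sym e
    ... | no ne | inj₂ (t , refl) = ⊥-elim (ne (Tr-℘ t))
    module D = ℕSum.Fibres _≟_
    ΣA≡N : ℕSum.Σ E A ≡ N
    ΣA≡N = sym (begin
      N                                                   ≡⟨ sym (ℕSum.Σ-one E) ⟩
      ℕSum.Σ E (λ _ → 1)                                  ≡⟨ D.fibre-sum E E ℘ (λ _ → 1) unique (λ t _ → complete _) ⟩
      ℕSum.Σ E (λ c → ℕSum.Σ E (λ t → D.sel (℘ t) c 1))   ≡⟨ ℕSum.Σ-cong E (λ c _ → ℕSum.Σ-cong E (λ t _ → D.sel-ind (℘ t) c)) ⟩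
      ℕSum.Σ E A                                          ∎)
    Σg≡N : ℕSum.Σ E g ≡ N
    Σg≡N = begin
      ℕSum.Σ E g                              ≡⟨ ℕSum.Σ-*ˡ E p I ⟩
      p ℕ.* ℕSum.count (λ c → TrL c ≟ 0#) E   ≡⟨ cong (p ℕ.*_) (fib-L 0# (Sub-∈ {p} Sp.fixed-0)) ⟩
      p ℕ.* p ℕ.^ m                           ≡⟨ sym |L| ⟩
      N                                       ∎
    f≤g : ∀ c → c ∈ E → f c ≤ g c
    f≤g c _ with TrL c ≟ 0#
    ... | yes _ = NP.≤-trans (NP.≤-reflexive (NP.+-identityʳ _)) (NP.≤-trans (A≤p c) (NP.≤-reflexive (sym (NP.*-identityʳ p))))
    ... | no _ = z≤n

  -- ℘ is F_p-linear, so A is invariant under scaling by F_p^×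
  A-scale : ∀ s w → s ≢ 0# → s ^ p ≡ s → A (s * w) ≡ A w
  A-scale s w s≢0 s∈Fp = trans
    (sym (ℕSum.Reindex.Σ-bij _≟_ E E (λ t → s * t) (λ t → inv s * t) (λ t → ℕSum.ind (℘ t ≟ (s * w))) unique unique
      (λ _ → complete _) (λ _ → complete _)
      (λ {t} _ → trans (sym (*-assoc _ _ _)) (trans (cong (_* t) (trans (*-comm _ _) (inv-r s s≢0))) (*-identityˡ t)))
      (λ {t} _ → trans (sym (*-assoc _ _ _)) (trans (cong (_* t) (inv-r s s≢0)) (*-identityˡ t)))))
    (ℕSum.count-cong (λ t → ℘ (s * t) ≟ (s * w)) (λ t → ℘ t ≟ w) E
      (λ t _ e → *-cancelˡ s _ _ s≢0 (trans (sym (℘-scale t)) e))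
      (λ t _ e → trans (℘-scale t) (cong (s *_) e)))
    where
    ℘-scale : ∀ t → ℘ (s * t) ≡ s * ℘ t
    ℘-scale t = trans (cong (_+ - (s * t)) (trans (*-^ s t p) (cong (_* t ^ p) s∈Fp)))
                      (solve 3 (λ s a t → s :* a :- s :* t := s :* (a :- t)) refl s (t ^ p) t)

-- The setting of the theorem: |L| = q^n with q = p^r, p prime, r, n ≥ 1
-- (written r = suc r', n = suc n').
module Setting (L : FiniteField) (p r' n' : ℕ) (pp : Prime p)
               (hN : FiniteField.card L ≡ (p ℕ.^ suc r') ℕ.^ suc n') where
  open ListSums

  r n q M M' : ℕ
  r = suc r'
  n = suc n'
  q = p ℕ.^ r
  M = n ℕ.* r
  M' = r' ℕ.+ n' ℕ.* r  -- M = suc M' definitionally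

  N≡p^M : FiniteField.card L ≡ p ℕ.^ M
  N≡p^M = trans hN (trans (NP.^-*-assoc p r n) (cong (p ℕ.^_) (NP.*-comm r n)))

  open ArtinSchreier L p M' pp N≡p^M public

  q>1 : 1 < q
  q>1 = NP.<-≤-trans p>1 (NP.≤-trans (NP.≤-reflexive (sym (NP.*-identityʳ p))) (NP.*-monoʳ-≤ p (p^>0 r')))

  q>0 : 0 < q
  q>0 = NP.<-trans (s≤s z≤n) q>1

  q^>0 : ∀ i → 0 < q ℕ.^ i
  q^>0 i = NP.m^n>0 q {{ℕ.>-nonZero q>0}} i

  additive-q^ : ∀ i → Additive (q ℕ.^ i)
  additive-q^ = Additive-^ q (additive-p^ r)

  module Sq = FixedField q q>0 (additive-p^ r)

  Fq : List Carrier
  Fq = Sub q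

  Fp⊆Fq : ∀ {s} → s ^ p ≡ s → s ^ q ≡ s
  Fp⊆Fq hs = Sp.fixed-^ hs r

  Trq Trpr : Carrier → Carrier
  Trq = Tr q n
  Trpr = Tr p r

  L/Fq : TraceEquidistributed q n' E
  L/Fq = trace-equidistributed q n' E q>1 (additive-p^ r) unique hN (λ x _ → subst (λ k → x ^ k ≡ x) hN (x^N≡x x))

  Fq/Fp : TraceEquidistributed p r' Fq
  Fq/Fp = trace-equidistributed p r' Fq p>1 frob-p (Sub-unique q) (TraceEquidistributed.|Sub| L/Fq) (λ x x∈ → Sub-eq {q} x∈)

  |Fq| : length Fq ≡ q
  |Fq| = TraceEquidistributed.|Sub| L/Fq

  fib-q : ∀ w → w ∈ Fq → ℕSum.count (λ x → Trq x ≟ w) E ≡ q ℕ.^ n'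
  fib-q = TraceEquidistributed.fibre L/Fq

  fib-pr : ∀ w → w ∈ Fp → ℕSum.count (λ x → Trpr x ≟ w) Fq ≡ p ℕ.^ r'
  fib-pr = TraceEquidistributed.fibre Fq/Fp

  Trq-Fq : ∀ x → Trq x ^ q ≡ Trq x
  Trq-Fq x = Tr-Sub q n' x q>1 (additive-p^ r) (subst (λ k → x ^ k ≡ x) hN (x^N≡x x))

-- Transitivity and linearity of traces, and the count
--   K(a, b) = #{γ ∈ F_q : Tr_{F_q/F_p}(a·γ + b) = 0},
-- which is q/p for a ≠ 0 (γ ↦ aγ + b permutes F_q) and q·[Tr b = 0] for a = 0.
module TraceTower (L : FiniteField) (p r' n' : ℕ) (pp : Prime p)
                  (hN : FiniteField.card L ≡ (p ℕ.^ suc r') ℕ.^ suc n') where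
  open ListSums
  open Setting L p r' n' pp hN public
  open ≡-Reasoning

  tower : ∀ c → TrL c ≡ Trpr (Trq c)
  tower c = begin
    sumUpTo (n ℕ.* r) (λ i → c ^ (p ℕ.^ i))                          ≡⟨ blocks n r _ ⟩
    sumUpTo n (λ k → sumUpTo r (λ j → c ^ (p ℕ.^ (k ℕ.* r ℕ.+ j))))   ≡⟨ range-cong n _ _ (λ k _ → range-cong r _ _ (λ j _ → term k j)) ⟩
    sumUpTo n (λ k → sumUpTo r (λ j → (c ^ (q ℕ.^ k)) ^ (p ℕ.^ j)))  ≡⟨ range-swap n r _ ⟩
    sumUpTo r (λ j → sumUpTo n (λ k → (c ^ (q ℕ.^ k)) ^ (p ℕ.^ j)))  ≡⟨ range-cong r _ _ (λ j _ → sym (Additive-sum (p ℕ.^ j) (p^>0 j) (additive-p^ j) n _)) ⟩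
    sumUpTo r (λ j → (Trq c) ^ (p ℕ.^ j))                            ∎
    where
    exponent : ∀ k j → p ℕ.^ (k ℕ.* r ℕ.+ j) ≡ q ℕ.^ k ℕ.* p ℕ.^ j
    exponent k j = trans (NP.^-distribˡ-+-* p (k ℕ.* r) j)
                         (cong (ℕ._* p ℕ.^ j) (trans (cong (p ℕ.^_) (NP.*-comm k r)) (sym (NP.^-*-assoc p r k))))
    term : ∀ k j → c ^ (p ℕ.^ (k ℕ.* r ℕ.+ j)) ≡ (c ^ (q ℕ.^ k)) ^ (p ℕ.^ j)
    term k j = trans (cong (c ^_) (exponent k j)) (^-* c (q ℕ.^ k) (p ℕ.^ j))

  Trq-linear : ∀ a b x y → a ^ q ≡ a → b ^ q ≡ b → Trq (a * x + b * y) ≡ a * Trq x + b * Trq y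
  Trq-linear a b x y ha hb = begin
    sumUpTo n (λ i → (a * x + b * y) ^ (q ℕ.^ i))                               ≡⟨ range-cong n _ _ (λ i _ → term i) ⟩
    sumUpTo n (λ i → a * x ^ (q ℕ.^ i) + b * y ^ (q ℕ.^ i))                     ≡⟨ range-+ n _ _ ⟩
    sumUpTo n (λ i → a * x ^ (q ℕ.^ i)) + sumUpTo n (λ i → b * y ^ (q ℕ.^ i))   ≡⟨ sym (cong₂ _+_ (range-*ˡ n a _) (range-*ˡ n b _)) ⟩
    a * Trq x + b * Trq y                                                       ∎
    where
    scale : ∀ {c} i z → c ^ q ≡ c → (c * z) ^ (q ℕ.^ i) ≡ c * z ^ (q ℕ.^ i)
    scale {c} i z hc = trans (*-^ c z (q ℕ.^ i)) (cong (_* z ^ (q ℕ.^ i)) (Sq.fixed-^ hc i))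
    term : ∀ i → (a * x + b * y) ^ (q ℕ.^ i) ≡ a * x ^ (q ℕ.^ i) + b * y ^ (q ℕ.^ i)
    term i = trans (additive-q^ i _ _) (cong₂ _+_ (scale i x ha) (scale i y hb))

  K : Carrier → Carrier → ℕ
  K a b = ℕSum.count (λ γ → Trpr (a * γ + b) ≟ 0#) Fq

  K-nonzero : ∀ a b → a ^ q ≡ a → b ^ q ≡ b → a ≢ 0# → K a b ≡ p ℕ.^ r'
  K-nonzero a b ha hb a≢0 = trans
    (ℕSum.Reindex.Σ-bij _≟_ Fq Fq σ τ (λ w → ℕSum.ind (Trpr w ≟ 0#)) (Sub-unique q) (Sub-unique q)
      (λ m → Sub-∈ {q} (Sq.fixed-+ (Sq.fixed-* ha (Sub-eq {q} m)) hb))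
      (λ m → Sub-∈ {q} (Sq.fixed-* (Sq.fixed-inv ha) (Sq.fixed-+ (Sub-eq {q} m) (Sq.fixed-neg hb))))
      (λ {γ} _ → trans (cong (inv a *_) (solve 3 (λ a γ b → (a :* γ :+ b) :- b := a :* γ) refl a γ b))
                       (trans (sym (*-assoc _ _ _)) (trans (cong (_* γ) (trans (*-comm _ _) (inv-r a a≢0))) (*-identityˡ γ))))
      (λ {w} _ → trans (cong (_+ b) (trans (sym (*-assoc _ _ _)) (trans (cong (_* (w + - b)) (inv-r a a≢0)) (*-identityˡ _))))
                       (solve 2 (λ w b → (w :- b) :+ b := w) refl w b)))
    (fib-pr 0# (Sub-∈ {p} Sp.fixed-0))
    where
    σ τ : Carrier → Carrier
    σ γ = a * γ + b
    τ w = inv a * (w + - b)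

  K-zero : ∀ b → K 0# b ≡ q ℕ.* ℕSum.ind (Trpr b ≟ 0#)
  K-zero b = trans
    (ℕSum.Σ-cong Fq (λ γ _ → cong (λ z → ℕSum.ind (Trpr z ≟ 0#)) (trans (cong (_+ b) (zeroˡ γ)) (+-identityˡ b))))
    (trans (ℕSum.Σ-const Fq (ℕSum.ind (Trpr b ≟ 0#))) (cong (ℕ._* ℕSum.ind (Trpr b ≟ 0#)) |Fq|))

module Cosets (L : FiniteField) (p r' n' : ℕ) (pp : Prime p)
              (hN : FiniteField.card L ≡ (p ℕ.^ suc r') ℕ.^ suc n')
              (B : List (FiniteField.Carrier L)) (cr : FiniteField.IsCosetReps L p (p ℕ.^ suc r') B) where
  open ListSums
  open TraceTower L p r' n' pp hN public
  open IsCosetReps cr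
  open ≡-Reasoning

  Up U : List Carrier
  Up = subUnits p
  U = subUnits q

  p1 : ℕ
  p1 = p ℕ.∸ 1

  p≡suc-p1 : p ≡ suc p1
  p≡suc-p1 = sym (NP.suc-pred p {{ℕ.>-nonZero p>0}})

  |Up| : length Up ≡ p1
  |Up| = cong (ℕ._∸ 1) (trans (sym (|units|+1 p Sp.fixed-0)) |Fp|)

  |U|+1 : 1 ℕ.+ length U ≡ q
  |U|+1 = trans (sym (|units|+1 q Sq.fixed-0)) |Fq|

  CL : List Carrier → List Carrier
  CL [] = []
  CL (β ∷ bs) = map (λ s → s * β) Up ++ CL bs

  Σ-CL : ∀ bs (f : Carrier → ℕ) → ℕSum.Σ (CL bs) f ≡ ℕSum.Σ bs (λ β → ℕSum.Σ Up (λ s → f (s * β)))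
  Σ-CL [] f = refl
  Σ-CL (β ∷ bs) f = trans (ℕSum.Σ-++ (map (λ s → s * β) Up) (CL bs) f) (cong₂ ℕ._+_ (ℕSum.Σ-map (λ s → s * β) Up f) (Σ-CL bs f))

  CL-∈⁻ : ∀ bs {x} → x ∈ CL bs → Σ[ β ∈ Carrier ] (β ∈ bs × Σ[ s ∈ Carrier ] (s ∈ Up × x ≡ s * β))
  CL-∈⁻ (β ∷ bs) mem with MP.∈-++⁻ (map (λ s → s * β) Up) mem
  ... | inj₁ m1 = case MP.∈-map⁻ (λ s → s * β) m1 of λ { (s , s∈ , e) → β , here refl , s , s∈ , e }
  ... | inj₂ m2 = case CL-∈⁻ bs m2 of λ { (β' , β'∈ , s , s∈ , e) → β' , there β'∈ , s , s∈ , e }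

  CL-∈⁺ : ∀ bs {β s} → β ∈ bs → s ∈ Up → s * β ∈ CL bs
  CL-∈⁺ (β ∷ bs) {s = s} (here refl) s∈ = MP.∈-++⁺ˡ (MP.∈-map⁺ (λ s → s * β) s∈)
  CL-∈⁺ (β ∷ bs) (there m) s∈ = MP.∈-++⁺ʳ (map (λ s → s * β) Up) (CL-∈⁺ bs m s∈)

  β≢0 : ∀ {β} → β ∈ B → β ≢ 0#
  β≢0 m = proj₁ (inFqUnits _ m)

  CL-unique : ∀ bs → Unique bs → (∀ {β} → β ∈ bs → β ∈ B) → Unique (CL bs)
  CL-unique [] _ _ = []
  CL-unique (β ∷ bs) (β∉ ∷ u) sub = UP.++⁺ (ℕSum.Reindex.map-unique _≟_ (λ s → s * β) Up (SU-unique p) inj) (CL-unique bs u (λ m → sub (there m))) disj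
    where
    βB = sub (here refl)
    inj : ∀ {a b} → a ∈ Up → b ∈ Up → a * β ≡ b * β → a ≡ b
    inj {a} {b} _ _ e = *-cancelˡ β a b (β≢0 βB) (trans (*-comm β a) (trans e (*-comm b β)))
    disj : ∀ {v} → ¬ (v ∈ map (λ s → s * β) Up × v ∈ CL bs)
    disj (m1 , m2) with MP.∈-map⁻ (λ s → s * β) m1 | CL-∈⁻ bs m2
    ... | (s , s∈ , e1) | (β' , β'∈ , s' , s'∈ , e2) = All.lookup β∉ β'∈ (separate β β' βB (sub (there β'∈)) c c≢0 cp ceq)
      where
      s≢0 = proj₁ (SU-prop {p} s∈)
      c = inv s * s'
      c≢0 : c ≢ 0#
      c≢0 = *≢0 (inv≢0 s s≢0) (proj₁ (SU-prop {p} s'∈))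
      cp : InSub p c
      cp = Sp.fixed-* (Sp.fixed-inv (proj₂ (SU-prop {p} s∈))) (proj₂ (SU-prop {p} s'∈))
      ceq : β ≡ c * β'
      ceq = begin
        β ≡⟨ sym (trans (sym (*-assoc _ _ _)) (trans (cong (_* β) (trans (*-comm _ _) (inv-r s s≢0))) (*-identityˡ β))) ⟩
        inv s * (s * β) ≡⟨ cong (inv s *_) (trans (sym e1) e2) ⟩
        inv s * (s' * β') ≡⟨ sym (*-assoc _ _ _) ⟩
        c * β' ∎

  coset : ∀ (f : Carrier → ℕ) → ℕSum.Σ U f ≡ ℕSum.Σ B (λ β → ℕSum.Σ Up (λ s → f (s * β)))
  coset f = trans (ℕSum.Reindex.Σ-perm _≟_ U (CL B) f (SU-unique q) (CL-unique B distinct (λ m → m)) to fro) (Σ-CL B f)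
    where
    to : ∀ {x} → x ∈ U → x ∈ CL B
    to {x} mem with covers x (proj₁ (SU-prop {q} mem)) (proj₂ (SU-prop {q} mem))
    ... | (β , β∈ , c , c≢0 , cp , e) = subst (_∈ CL B) (sym e) (CL-∈⁺ B β∈ (SU-∈ {p} c≢0 cp))
    fro : ∀ {x} → x ∈ CL B → x ∈ U
    fro mem with CL-∈⁻ B mem
    ... | (β , β∈ , s , s∈ , refl) = SU-∈ {q} (*≢0 (proj₁ (SU-prop {p} s∈)) (β≢0 β∈)) (Sq.fixed-* (Fp⊆Fq (proj₂ (SU-prop {p} s∈))) (proj₂ (inFqUnits β β∈)))

  |B| : p1 ℕ.* length B ≡ length U
  |B| = sym (begin
    length U ≡⟨ sym (ℕSum.Σ-one U) ⟩
    ℕSum.Σ U (λ _ → 1) ≡⟨ coset (λ _ → 1) ⟩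
    ℕSum.Σ B (λ _ → ℕSum.Σ Up (λ _ → 1)) ≡⟨ ℕSum.Σ-cong B (λ _ _ → trans (ℕSum.Σ-one Up) |Up|) ⟩
    ℕSum.Σ B (λ _ → p1) ≡⟨ trans (ℕSum.Σ-const B p1) (NP.*-comm _ p1) ⟩
    p1 ℕ.* length B ∎)

  -- (p-1)·Σ_{β∈B} A(βc) = Σ_{γ∈F_q^×} A(γc), since A is F_p^×-invariant
  coset-A : ∀ c → p1 ℕ.* ℕSum.Σ B (λ β → A (β * c)) ≡ ℕSum.Σ U (λ γ → A (γ * c))
  coset-A c = begin
    p1 ℕ.* ℕSum.Σ B (λ β → A (β * c)) ≡⟨ sym (ℕSum.Σ-*ˡ B p1 _) ⟩
    ℕSum.Σ B (λ β → p1 ℕ.* A (β * c)) ≡⟨ ℕSum.Σ-cong B (λ β _ → sym (orbit β)) ⟩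
    ℕSum.Σ B (λ β → ℕSum.Σ Up (λ s → A ((s * β) * c))) ≡⟨ sym (coset (λ γ → A (γ * c))) ⟩
    ℕSum.Σ U (λ γ → A (γ * c)) ∎
    where
    orbit : ∀ β → ℕSum.Σ Up (λ s → A ((s * β) * c)) ≡ p1 ℕ.* A (β * c)
    orbit β = trans (ℕSum.Σ-cong Up (λ s s∈ → trans (cong A (*-assoc s β c)) (A-scale s (β * c) (proj₁ (SU-prop {p} s∈)) (proj₂ (SU-prop {p} s∈)))))
                    (trans (ℕSum.Σ-const Up _) (cong (ℕ._* A (β * c)) |Up|))

-- By Artin–Schreier,
-- the tower and linearity, A(δ/z - γz) = p·G(z,γ,δ) with
--   G(z,γ,δ) = [Tr_{F_q/F_p}(R·δ - γ·T) = 0].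
module TraceCounting (L : FiniteField) (p r' n' : ℕ) (pp : Prime p)
                     (hN : FiniteField.card L ≡ (p ℕ.^ suc r') ℕ.^ suc n')
                     (B : List (FiniteField.Carrier L)) (cr : FiniteField.IsCosetReps L p (p ℕ.^ suc r') B) where
  open ListSums
  open Cosets L p r' n' pp hN B cr public
  open ≡-Reasoning

  q' : ℕ
  q' = p ℕ.^ r'   -- q = p·q' definitionally, and q' = |F_q|/p

  T R : Carrier → Carrier
  T z = Trq z
  R z = Trq (inv z)

  T∈Fq : ∀ z → T z ^ q ≡ T z
  T∈Fq z = Trq-Fq z

  R∈Fq : ∀ z → R z ^ q ≡ R z
  R∈Fq z = Trq-Fq (inv z)

  U⊆Fq : ∀ {x} → x ∈ U → x ^ q ≡ x
  U⊆Fq m = proj₂ (SU-prop {q} m)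

  Trpr0 : Trpr 0# ≡ 0#
  Trpr0 = range-0 r _ (λ i _ → 0^pos (p ℕ.^ i) (p^>0 i))

  G : Carrier → Carrier → Carrier → ℕ
  G z γ δ = ℕSum.ind (Trpr (R z * δ + (- γ) * T z) ≟ 0#)

  Inner GU GF : Carrier → ℕ
  Inner z = ℕSum.Σ U (λ α → ℕSum.Σ B (λ β → A (β * (α * inv z + - z))))
  GU z = ℕSum.Σ U (λ γ → ℕSum.Σ U (λ δ → G z γ δ))
  GF z = ℕSum.Σ Fq (λ γ → ℕSum.Σ Fq (λ δ → G z γ δ))

  -- A at δ/z - γz is p·G, by Artin–Schreier, the tower and F_q-linearity
  A-G : ∀ z γ δ → γ ^ q ≡ γ → δ ^ q ≡ δ → A (δ * inv z + (- γ) * z) ≡ p ℕ.* G z γ δ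
  A-G z γ δ hγ hδ = trans (A-formula _) (cong (λ w → p ℕ.* ℕSum.ind (w ≟ 0#)) (begin
    TrL (δ * inv z + (- γ) * z)          ≡⟨ tower _ ⟩
    Trpr (Trq (δ * inv z + (- γ) * z))   ≡⟨ cong Trpr (Trq-linear δ (- γ) (inv z) z hδ (Sq.fixed-neg hγ)) ⟩
    Trpr (δ * R z + (- γ) * T z)         ≡⟨ cong (λ w → Trpr (w + (- γ) * T z)) (*-comm δ (R z)) ⟩
    Trpr (R z * δ + (- γ) * T z)         ∎))

  -- substituting δ = γα:  Σ_α A(γ(α/z - z)) = Σ_δ A(δ/z - γz)
  dilate : ∀ z γ → γ ∈ U → ℕSum.Σ U (λ α → A (γ * (α * inv z + - z))) ≡ ℕSum.Σ U (λ δ → A (δ * inv z + (- γ) * z))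
  dilate z γ γ∈ = trans
    (ℕSum.Σ-cong U (λ α _ → cong A (solve 4 (λ g a i z → g :* (a :* i :- z) := (g :* a) :* i :+ (:- g) :* z) refl γ α (inv z) z)))
    (ℕSum.Reindex.Σ-bij _≟_ U U (λ α → γ * α) (λ δ → inv γ * δ) (λ δ → A (δ * inv z + (- γ) * z)) (SU-unique q) (SU-unique q)
      (λ m → SU-∈ {q} (*≢0 γ≢0 (proj₁ (SU-prop {q} m))) (Sq.fixed-* (U⊆Fq γ∈) (U⊆Fq m)))
      (λ m → SU-∈ {q} (*≢0 (inv≢0 γ γ≢0) (proj₁ (SU-prop {q} m))) (Sq.fixed-* (Sq.fixed-inv (U⊆Fq γ∈)) (U⊆Fq m)))
      (λ {α} _ → trans (sym (*-assoc _ _ _)) (trans (cong (_* α) (trans (*-comm _ _) (inv-r γ γ≢0))) (*-identityˡ α)))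
      (λ {δ} _ → trans (sym (*-assoc _ _ _)) (trans (cong (_* δ) (inv-r γ γ≢0)) (*-identityˡ δ))))
    where γ≢0 = proj₁ (SU-prop {q} γ∈)

  Inner-GU : ∀ z → z ≢ 0# → p1 ℕ.* Inner z ≡ p ℕ.* GU z
  Inner-GU z z≢0 = begin
    p1 ℕ.* Inner z                                                      ≡⟨ sym (ℕSum.Σ-*ˡ U p1 _) ⟩
    ℕSum.Σ U (λ α → p1 ℕ.* ℕSum.Σ B (λ β → A (β * (α * inv z + - z))))  ≡⟨ ℕSum.Σ-cong U (λ α _ → coset-A (α * inv z + - z)) ⟩
    ℕSum.Σ U (λ α → ℕSum.Σ U (λ γ → A (γ * (α * inv z + - z))))         ≡⟨ ℕSum.Σ-swap U U _ ⟩
    ℕSum.Σ U (λ γ → ℕSum.Σ U (λ α → A (γ * (α * inv z + - z))))         ≡⟨ ℕSum.Σ-cong U (λ γ γ∈ → dilate z γ γ∈) ⟩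
    ℕSum.Σ U (λ γ → ℕSum.Σ U (λ δ → A (δ * inv z + (- γ) * z)))         ≡⟨ ℕSum.Σ-cong U (λ γ γ∈ → ℕSum.Σ-cong U (λ δ δ∈ → A-G z γ δ (U⊆Fq γ∈) (U⊆Fq δ∈))) ⟩
    ℕSum.Σ U (λ γ → ℕSum.Σ U (λ δ → p ℕ.* G z γ δ))                     ≡⟨ ℕSum.Σ-cong U (λ γ _ → ℕSum.Σ-*ˡ U p _) ⟩
    ℕSum.Σ U (λ γ → p ℕ.* ℕSum.Σ U (λ δ → G z γ δ))                     ≡⟨ ℕSum.Σ-*ˡ U p _ ⟩
    p ℕ.* GU z                                                          ∎

  -- splitting F_q = {0} ∪ F_q^× in both variables: GF + 1 = K(R,0) + K(-T,0) + GU
  split-GF : ∀ z → GF z ℕ.+ 1 ≡ K (R z) 0# ℕ.+ K (- T z) 0# ℕ.+ GU z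
  split-GF z = begin
    GF z ℕ.+ 1                                        ≡⟨ cong (ℕ._+ 1) (Sub-split q row Sq.fixed-0) ⟩
    (row 0# ℕ.+ ℕSum.Σ U row) ℕ.+ 1                   ≡⟨ cong₂ (λ u v → (u ℕ.+ v) ℕ.+ 1) row-0 (ℕSum.Σ-cong U (λ γ _ → Sub-split q (G z γ) Sq.fixed-0)) ⟩
    (K (R z) 0# ℕ.+ ℕSum.Σ U (λ γ → G z γ 0# ℕ.+ ℕSum.Σ U (G z γ))) ℕ.+ 1
                                                      ≡⟨ cong (λ w → (K (R z) 0# ℕ.+ w) ℕ.+ 1) (ℕSum.Σ-∙ U (λ γ → G z γ 0#) (λ γ → ℕSum.Σ U (G z γ))) ⟩
    (K (R z) 0# ℕ.+ (column ℕ.+ GU z)) ℕ.+ 1          ≡⟨ rearrange (K (R z) 0#) column (GU z) ⟩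
    K (R z) 0# ℕ.+ (1 ℕ.+ column) ℕ.+ GU z            ≡⟨ cong (λ w → K (R z) 0# ℕ.+ w ℕ.+ GU z) (sym column-0) ⟩
    K (R z) 0# ℕ.+ K (- T z) 0# ℕ.+ GU z              ∎
    where
    row : Carrier → ℕ
    row γ = ℕSum.Σ Fq (G z γ)
    column : ℕ
    column = ℕSum.Σ U (λ γ → G z γ 0#)
    rearrange : ∀ a b c → (a ℕ.+ (b ℕ.+ c)) ℕ.+ 1 ≡ a ℕ.+ (1 ℕ.+ b) ℕ.+ c
    rearrange a b c = trans (NP.+-assoc a (b ℕ.+ c) 1) (trans (cong (a ℕ.+_) (NP.+-comm (b ℕ.+ c) 1)) (sym (NP.+-assoc a (1 ℕ.+ b) c)))
    -γT-at-0 : (- 0#) * T z ≡ 0#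
    -γT-at-0 = trans (cong (_* T z) -0#≈0#) (zeroˡ _)
    row-0 : row 0# ≡ K (R z) 0#
    row-0 = ℕSum.Σ-cong Fq (λ δ _ → cong (λ w → ℕSum.ind (Trpr (R z * δ + w) ≟ 0#)) -γT-at-0)
    G-at-00 : G z 0# 0# ≡ 1
    G-at-00 with Trpr (R z * 0# + (- 0#) * T z) ≟ 0#
    ... | yes _ = refl
    ... | no ne = ⊥-elim (ne (trans (cong Trpr (trans (cong₂ _+_ (zeroʳ _) -γT-at-0) (+-identityˡ 0#))) Trpr0))
    column-0 : K (- T z) 0# ≡ 1 ℕ.+ column
    column-0 = begin
      K (- T z) 0#                  ≡⟨ ℕSum.Σ-cong Fq (λ γ _ → cong (λ w → ℕSum.ind (Trpr w ≟ 0#)) (swap γ)) ⟩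
      ℕSum.Σ Fq (λ γ → G z γ 0#)    ≡⟨ Sub-split q (λ γ → G z γ 0#) Sq.fixed-0 ⟩
      G z 0# 0# ℕ.+ column          ≡⟨ cong (ℕ._+ column) G-at-00 ⟩
      1 ℕ.+ column                  ∎
      where
      swap : ∀ γ → (- T z) * γ + 0# ≡ R z * 0# + (- γ) * T z
      swap γ = solve 3 (λ t g r → (:- t) :* g :+ con (pos 0) := r :* con (pos 0) :+ (:- g) :* t) refl (T z) γ (R z)

  K-at-zero : ∀ a → a ≡ 0# → K a 0# ≡ q
  K-at-zero a refl = trans (K-zero 0#) (trans (cong (q ℕ.*_) ind-Trpr0) (NP.*-identityʳ q))
    where
    ind-Trpr0 : ℕSum.ind (Trpr 0# ≟ 0#) ≡ 1
    ind-Trpr0 with Trpr 0# ≟ 0#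
    ... | yes _ = refl
    ... | no ne = ⊥-elim (ne Trpr0)

  K-at-unit : ∀ a → a ^ q ≡ a → a ≢ 0# → K a 0# ≡ q'
  K-at-unit a ha a≢0 = K-nonzero a 0# ha Sq.fixed-0 a≢0

  K-R-value : ∀ z → K (R z) 0# ≡ ℕSum.pick (R z ≟ 0#) q q'
  K-R-value z with R z ≟ 0#
  ... | yes e = K-at-zero (R z) e
  ... | no ne = K-at-unit (R z) (R∈Fq z) ne

  K-T-value : ∀ z (d : Dec (T z ≡ 0#)) → K (- T z) 0# ≡ ℕSum.pick d q q'
  K-T-value z (yes e) = K-at-zero (- T z) (trans (cong -_ e) -0#≈0#)
  K-T-value z (no ne) = K-at-unit (- T z) (Sq.fixed-neg (T∈Fq z)) (λ e → ne (trans (sym (-‿involutive _)) (trans (cong -_ e) -0#≈0#)))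

  R×T≡0? : ∀ z → Dec ((R z ≡ 0#) × (T z ≡ 0#))
  R×T≡0? z = (R z ≟ 0#) ×-dec (T z ≟ 0#)

  -- if R(z) = 0 then G(z,γ,δ) does not depend on δ
  GF-R≡0 : ∀ {z} → R z ≡ 0# → GF z ≡ q ℕ.* K (- T z) 0#
  GF-R≡0 {z} e = begin
    GF z                                                         ≡⟨ ℕSum.Σ-cong Fq (λ γ _ → trans (cong (λ w → K w ((- γ) * T z)) e) (K-zero ((- γ) * T z))) ⟩
    ℕSum.Σ Fq (λ γ → q ℕ.* ℕSum.ind (Trpr ((- γ) * T z) ≟ 0#))   ≡⟨ ℕSum.Σ-*ˡ Fq q _ ⟩
    q ℕ.* ℕSum.Σ Fq (λ γ → ℕSum.ind (Trpr ((- γ) * T z) ≟ 0#))   ≡⟨ cong (q ℕ.*_) (ℕSum.Σ-cong Fq (λ γ _ → cong (λ w → ℕSum.ind (Trpr w ≟ 0#)) (swap γ))) ⟩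
    q ℕ.* K (- T z) 0#                                           ∎
    where
    swap : ∀ γ → (- γ) * T z ≡ (- T z) * γ + 0#
    swap γ = solve 2 (λ g t → (:- g) :* t := (:- t) :* g :+ con (pos 0)) refl γ (T z)

  GF-value : ∀ z → GF z ≡ ℕSum.pick (R×T≡0? z) (q ℕ.* q) (q ℕ.* q')
  GF-value z with R z ≟ 0# | T z ≟ 0#
  ... | no ne | _ = trans (ℕSum.Σ-cong Fq (λ γ γ∈ → K-nonzero (R z) ((- γ) * T z) (R∈Fq z) (Sq.fixed-* (Sq.fixed-neg (Sub-eq {q} γ∈)) (T∈Fq z)) ne))
                          (trans (ℕSum.Σ-const Fq q') (cong (ℕ._* q') |Fq|))
  ... | yes e | d = trans (GF-R≡0 e) (trans (cong (q ℕ.*_) (K-T-value z d)) (by-cases d))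
    where
    by-cases : ∀ (d : Dec (T z ≡ 0#)) → q ℕ.* ℕSum.pick d q q' ≡ ℕSum.pick (yes e ×-dec d) (q ℕ.* q) (q ℕ.* q')
    by-cases (yes _) = refl
    by-cases (no _) = refl

module ClosingArithmetic where
  open import Data.Integer using (_+_; _*_; _-_)
  open import Data.Integer.Solver using (module +-*-Solver)
  open +-*-Solver
  open ListSums
  open ≡-Reasoning

  cast-sub : ∀ {x y z : ℕ} → x ℕ.+ y ≡ z → pos x ≡ pos z - pos y
  cast-sub {x} {y} {z} h = begin
    pos x                       ≡⟨ solve 2 (λ x y → x := (x :+ y) :- y) refl (pos x) (pos y) ⟩
    (pos x + pos y) - pos y     ≡⟨ cong (_- pos y) (trans (sym (ℤP.pos-+ x y)) (cong pos h)) ⟩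
    pos z - pos y               ∎

  cast-pick : ∀ {X a l : ℕ} c b → X ℕ.+ c ℕ.* b ≡ c ℕ.* a ℕ.+ l ℕ.* b →
              pos X ≡ pos c * pos a + (pos l - pos c) * pos b
  cast-pick {X} {a} {l} c b h = begin
    pos X                                          ≡⟨ cast-sub h ⟩
    pos (c ℕ.* a ℕ.+ l ℕ.* b) - pos (c ℕ.* b)      ≡⟨ cong₂ _-_ (trans (ℤP.pos-+ (c ℕ.* a) (l ℕ.* b)) (cong₂ _+_ (ℤP.pos-* c a) (ℤP.pos-* l b)))
                                                               (ℤP.pos-* c b) ⟩
    (pos c * pos a + pos l * pos b) - pos c * pos b ≡⟨ solve 4 (λ c a l b → (c :* a :+ l :* b) :- c :* b := c :* a :+ (l :- c) :* b) refl (pos c) (pos a) (pos l) (pos b) ⟩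
    pos c * pos a + (pos l - pos c) * pos b        ∎

  sumℤ-cong : ∀ {X : Set} (f g : X → ℤ) xs → (∀ x → x ∈ xs → f x ≡ g x) → sumℤ f xs ≡ sumℤ g xs
  sumℤ-cong f g [] h = refl
  sumℤ-cong f g (x ∷ xs) h = cong₂ _+_ (h x (here refl)) (sumℤ-cong f g xs (λ y m → h y (there m)))

  sumℤ-shift : ∀ {X : Set} (f : X → ℕ) (K : ℕ) xs →
               sumℤ (λ x → pos (f x) - pos K) xs ≡ pos (ℕSum.Σ xs f) - pos (length xs ℕ.* K)
  sumℤ-shift f K [] = refl
  sumℤ-shift f K (x ∷ xs) = begin
    (pos (f x) - pos K) + sumℤ (λ x → pos (f x) - pos K) xs
      ≡⟨ cong ((pos (f x) - pos K) +_) (sumℤ-shift f K xs) ⟩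
    (pos (f x) - pos K) + (pos (ℕSum.Σ xs f) - pos (length xs ℕ.* K))
      ≡⟨ solve 4 (λ a k s m → (a :- k) :+ (s :- m) := (a :+ s) :- (k :+ m)) refl (pos (f x)) (pos K) (pos (ℕSum.Σ xs f)) (pos (length xs ℕ.* K)) ⟩
    (pos (f x) + pos (ℕSum.Σ xs f)) - (pos K + pos (length xs ℕ.* K))
      ≡⟨ cong₂ _-_ (sym (ℤP.pos-+ (f x) _)) (sym (ℤP.pos-+ K _)) ⟩
    pos (f x ℕ.+ ℕSum.Σ xs f) - pos (K ℕ.+ length xs ℕ.* K) ∎

  -- The hypotheses express every quantity through
  -- p = 1 + p₁, q' and Q (so q = p·q', N = q·Q = |L|), the number a of
  -- z ≠ 0 with T(z) = R(z) = 0, the number c of z ≠ 0 with T(z) = 0, and the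
  -- sums SX = Σ_z GU(z), SI = Σ_z Inner(z); GF, KR, KT are the sums over z ≠ 0
  -- of GF(z), K(R(z),0), K(-T(z),0), and nB = |B|, nU = |F_q^×|, n₁ = |L^×|.
  -- After cancelling p₁ the claim is a polynomial identity.
  closing : ∀ (p₁ q' Q a c nB SI : ℤ) {SX GF KR KT n₁ nU N q F : ℤ} →
    q ≡ (pos 1 + p₁) * q' → N ≡ q * Q → nU ≡ q - pos 1 → n₁ ≡ N - pos 1 → F ≡ pos 1 + a →
    GF ≡ a * (q * q) + (n₁ - a) * (q * q') →
    c ≡ Q - pos 1 → KR ≡ c * q + (n₁ - c) * q' → KT ≡ c * q + (n₁ - c) * q' →
    SX ≡ (GF + n₁) - (KR + KT) →
    p₁ * nB ≡ nU → p₁ * SI ≡ (pos 1 + p₁) * SX → p₁ ≢ pos 0 →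
    q * q * F ≡ N + nU * nU + (pos 2 * (nU * nB) + SI - nU * (nB * (N + pos 1)))
  closing p₁ q' Q a c nB SI refl refl refl refl refl refl refl refl refl refl hB hI p₁≢0 =
    ℤP.*-cancelˡ-≡ p₁ _ _ {{ℤ.≢-nonZero p₁≢0}} (begin
      p₁ * (q * q * (pos 1 + a))
        ≡⟨ solve 4 (λ p₁ q' Q a →
             let p = con (pos 1) :+ p₁
                 q = p :* q'
                 N = q :* Q
                 nU = q :- con (pos 1)
                 n₁ = N :- con (pos 1)
                 c = Q :- con (pos 1)
                 GF = a :* (q :* q) :+ (n₁ :- a) :* (q :* q')
                 K = c :* q :+ (n₁ :- c) :* q'
             in p₁ :* (q :* q :* (con (pos 1) :+ a))
                := p₁ :* (N :+ nU :* nU) :+ con (pos 2) :* (nU :* nU) :+ p :* ((GF :+ n₁) :- (K :+ K))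
                   :- nU :* nU :* (N :+ con (pos 1))) refl p₁ q' Q a ⟩
      p₁ * (N + nU * nU) + pos 2 * (nU * nU) + p * SX - nU * nU * (N + pos 1)
        ≡⟨ cong₂ (λ u v → p₁ * (N + nU * nU) + pos 2 * (nU * u) + v - nU * u * (N + pos 1)) (sym hB) (sym hI) ⟩
      p₁ * (N + nU * nU) + pos 2 * (nU * (p₁ * nB)) + p₁ * SI - nU * (p₁ * nB) * (N + pos 1)
        ≡⟨ solve 5 (λ p₁ N nU nB SI → p₁ :* (N :+ nU :* nU) :+ con (pos 2) :* (nU :* (p₁ :* nB)) :+ p₁ :* SI :- nU :* (p₁ :* nB) :* (N :+ con (pos 1))
                                      := p₁ :* (N :+ nU :* nU :+ (con (pos 2) :* (nU :* nB) :+ SI :- nU :* (nB :* (N :+ con (pos 1))))))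
                   refl p₁ N nU nB SI ⟩
      p₁ * (N + nU * nU + (pos 2 * (nU * nB) + SI - nU * (nB * (N + pos 1)))) ∎)
    where
    p = pos 1 + p₁
    q = p * q'
    N = q * Q
    nU = q - pos 1
    n₁ = N - pos 1
    GF = a * (q * q) + (n₁ - a) * (q * q')
    K = c * q + (n₁ - c) * q'
    SX = (GF + n₁) - (K + K)

module PointCount (L : FiniteField) (p r' n' : ℕ) (pp : Prime p)
                  (hN : FiniteField.card L ≡ (p ℕ.^ suc r') ℕ.^ suc n')
                  (B : List (FiniteField.Carrier L)) (cr : FiniteField.IsCosetReps L p (p ℕ.^ suc r') B) where
  open ListSums
  open TraceCounting L p r' n' pp hN B cr
  open CurvePoints L using (module Count)
  open ≡-Reasoning

  -- the curve count for β ≠ 0, with p written as k + 2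
  curve-count : ∀ α β → β ≢ 0# → curveCount p α β ≡ 2 ℕ.+ ℕSum.Σ NZ (λ z → A (β * (α * inv z + - z)))
  curve-count α β β≢0 = helper p p>1 refl
    where
    helper : ∀ P → 1 < P → P ≡ p → curveCount P α β ≡ 2 ℕ.+ ℕSum.Σ NZ (λ z → CurvePoints.AS L P (β * (α * inv z + - z)))
    helper (suc zero) (s≤s ()) _
    helper (suc (suc k)) _ _ = Count.curve-count k α β β≢0

  nU nB n₁ : ℕ
  nU = length U
  nB = length B
  n₁ = length NZ

  CC SI SX : ℕ
  CC = ℕSum.Σ U (λ α → ℕSum.Σ B (λ β → curveCount p α β))
  SI = ℕSum.Σ NZ Inner
  SX = ℕSum.Σ NZ GU

  CC≡ : CC ≡ 2 ℕ.* (nU ℕ.* nB) ℕ.+ SI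
  CC≡ = begin
    CC                                                      ≡⟨ ℕSum.Σ-cong U (λ α _ → ℕSum.Σ-cong B (λ β β∈ → curve-count α β (β≢0 β∈))) ⟩
    ℕSum.Σ U (λ α → ℕSum.Σ B (λ β → 2 ℕ.+ g α β))           ≡⟨ ℕSum.Σ-cong U (λ α _ → ℕSum.Σ-∙ B (λ _ → 2) (g α)) ⟩
    ℕSum.Σ U (λ α → ℕSum.Σ B (λ _ → 2) ℕ.+ ℕSum.Σ B (g α))   ≡⟨ ℕSum.Σ-∙ U (λ _ → ℕSum.Σ B (λ _ → 2)) (λ α → ℕSum.Σ B (g α)) ⟩
    ℕSum.Σ U (λ _ → ℕSum.Σ B (λ _ → 2)) ℕ.+ ℕSum.Σ U (λ α → ℕSum.Σ B (g α))
                                                            ≡⟨ cong₂ ℕ._+_ constant swapped ⟩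
    2 ℕ.* (nU ℕ.* nB) ℕ.+ SI                                ∎
    where
    g : Carrier → Carrier → ℕ
    g α β = ℕSum.Σ NZ (λ z → A (β * (α * inv z + - z)))
    constant : ℕSum.Σ U (λ _ → ℕSum.Σ B (λ _ → 2)) ≡ 2 ℕ.* (nU ℕ.* nB)
    constant = trans (ℕSum.Σ-const U _) (trans (cong (nU ℕ.*_) (ℕSum.Σ-const B 2))
                     (trans (sym (NP.*-assoc nU nB 2)) (NP.*-comm (nU ℕ.* nB) 2)))
    swapped : ℕSum.Σ U (λ α → ℕSum.Σ B (g α)) ≡ SI
    swapped = trans (ℕSum.Σ-cong U (λ α _ → ℕSum.Σ-swap B NZ _)) (ℕSum.Σ-swap U NZ _)

  ΣGF ΣKR ΣKT #R0 #T0 #RT0 : ℕ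
  ΣGF = ℕSum.Σ NZ GF
  ΣKR = ℕSum.Σ NZ (λ z → K (R z) 0#)
  ΣKT = ℕSum.Σ NZ (λ z → K (- T z) 0#)
  #R0 = ℕSum.count (λ z → R z ≟ 0#) NZ
  #T0 = ℕSum.count (λ z → T z ≟ 0#) NZ
  #RT0 = ℕSum.count R×T≡0? NZ

  ΣGF+n₁ : SX ℕ.+ (ΣKR ℕ.+ ΣKT) ≡ ΣGF ℕ.+ n₁
  ΣGF+n₁ = sym (begin
    ΣGF ℕ.+ n₁                                                  ≡⟨ cong (ΣGF ℕ.+_) (sym (ℕSum.Σ-one NZ)) ⟩
    ΣGF ℕ.+ ℕSum.Σ NZ (λ _ → 1)                                 ≡⟨ sym (ℕSum.Σ-∙ NZ GF (λ _ → 1)) ⟩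
    ℕSum.Σ NZ (λ z → GF z ℕ.+ 1)                                ≡⟨ ℕSum.Σ-cong NZ (λ z _ → split-GF z) ⟩
    ℕSum.Σ NZ (λ z → K (R z) 0# ℕ.+ K (- T z) 0# ℕ.+ GU z)      ≡⟨ ℕSum.Σ-∙ NZ _ GU ⟩
    ℕSum.Σ NZ (λ z → K (R z) 0# ℕ.+ K (- T z) 0#) ℕ.+ SX        ≡⟨ cong (ℕ._+ SX) (ℕSum.Σ-∙ NZ _ _) ⟩
    ΣKR ℕ.+ ΣKT ℕ.+ SX                                          ≡⟨ NP.+-comm (ΣKR ℕ.+ ΣKT) SX ⟩
    SX ℕ.+ (ΣKR ℕ.+ ΣKT)                                        ∎)

  Trq0 : Trq 0# ≡ 0#
  Trq0 = range-0 n _ (λ i _ → 0^pos (q ℕ.^ i) (q^>0 i))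

  #T0+1 : #T0 ℕ.+ 1 ≡ q ℕ.^ n'
  #T0+1 = begin
    #T0 ℕ.+ 1                              ≡⟨ NP.+-comm #T0 1 ⟩
    1 ℕ.+ #T0                              ≡⟨ cong (ℕ._+ #T0) (sym T0-at-0) ⟩
    ℕSum.ind (Trq 0# ≟ 0#) ℕ.+ #T0         ≡⟨ sym (Σ-zero-split (λ x → ℕSum.ind (Trq x ≟ 0#))) ⟩
    ℕSum.count (λ x → Trq x ≟ 0#) E        ≡⟨ fib-q 0# (Sub-∈ {q} Sq.fixed-0) ⟩
    q ℕ.^ n'                               ∎
    where
    T0-at-0 : ℕSum.ind (Trq 0# ≟ 0#) ≡ 1
    T0-at-0 with Trq 0# ≟ 0#
    ... | yes _ = refl
    ... | no ne = ⊥-elim (ne Trq0)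

  -- z ↦ 1/z exchanges the conditions R(z) = 0 and T(z) = 0
  #R0≡#T0 : #R0 ≡ #T0
  #R0≡#T0 = ℕSum.Reindex.Σ-bij _≟_ NZ NZ inv inv (λ z → ℕSum.ind (T z ≟ 0#)) NZ-unique NZ-unique
    (λ {z} m → NZ-∈ (inv≢0 z (NZ-≢ m))) (λ {z} m → NZ-∈ (inv≢0 z (NZ-≢ m))) (λ {z} _ → inv-inv z) (λ {z} _ → inv-inv z)

  rTr≡Tr-inv : ∀ a → rTr q n a ≡ Tr q n (inv a)
  rTr≡Tr-inv a with a ≟ 0#
  ... | yes _ = sym Trq0
  ... | no a≢0 = cong (λ w → sumUpTo n (λ i → w ^ (q ℕ.^ i))) (inv-unique a _ (proj₂ (inverse a a≢0)))

  Fq00≡ : Fq00 q n ≡ 1 ℕ.+ #RT0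
  Fq00≡ = begin
    Fq00 q n                           ≡⟨ ℕSum.length-filter trace-zero? E ⟩
    ℕSum.count trace-zero? E           ≡⟨ ℕSum.count-cong trace-zero? R×T≡0? E
                                            (λ a _ h → trans (sym (rTr≡Tr-inv a)) (proj₂ h) , proj₁ h)
                                            (λ a _ h → proj₂ h , trans (rTr≡Tr-inv a) (proj₁ h)) ⟩
    ℕSum.count R×T≡0? E                ≡⟨ Σ-zero-split (λ z → ℕSum.ind (R×T≡0? z)) ⟩
    ℕSum.ind (R×T≡0? 0#) ℕ.+ #RT0      ≡⟨ cong (ℕ._+ #RT0) at-0 ⟩
    1 ℕ.+ #RT0                         ∎
    where
    trace-zero? = λ a → (Tr q n a ≟ 0#) ×-dec (rTr q n a ≟ 0#)
    at-0 : ℕSum.ind (R×T≡0? 0#) ≡ 1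
    at-0 with R 0# ≟ 0# | T 0# ≟ 0#
    ... | yes _ | yes _ = refl
    ... | no ne | _ = ⊥-elim (ne (trans (cong Trq inv-0) Trq0))
    ... | yes _ | no ne = ⊥-elim (ne Trq0)

  ΣGF-cases : ΣGF ℕ.+ #RT0 ℕ.* (q ℕ.* q') ≡ #RT0 ℕ.* (q ℕ.* q) ℕ.+ n₁ ℕ.* (q ℕ.* q')
  ΣGF-cases = trans (cong (ℕ._+ #RT0 ℕ.* (q ℕ.* q')) (ℕSum.Σ-cong NZ (λ z _ → GF-value z)))
                    (ℕSum.Σ-pick R×T≡0? NZ (q ℕ.* q) (q ℕ.* q'))

  ΣKR-cases : ΣKR ℕ.+ #R0 ℕ.* q' ≡ #R0 ℕ.* q ℕ.+ n₁ ℕ.* q'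
  ΣKR-cases = trans (cong (ℕ._+ #R0 ℕ.* q') (ℕSum.Σ-cong NZ (λ z _ → K-R-value z))) (ℕSum.Σ-pick (λ z → R z ≟ 0#) NZ q q')

  ΣKT-cases : ΣKT ℕ.+ #T0 ℕ.* q' ≡ #T0 ℕ.* q ℕ.+ n₁ ℕ.* q'
  ΣKT-cases = trans (cong (ℕ._+ #T0 ℕ.* q') (ℕSum.Σ-cong NZ (λ z _ → K-T-value z (T z ≟ 0#)))) (ℕSum.Σ-pick (λ z → T z ≟ 0#) NZ q q')

  p₁·SI≡p·SX : p1 ℕ.* SI ≡ suc p1 ℕ.* SX
  p₁·SI≡p·SX = begin
    p1 ℕ.* SI                         ≡⟨ sym (ℕSum.Σ-*ˡ NZ p1 Inner) ⟩
    ℕSum.Σ NZ (λ z → p1 ℕ.* Inner z)  ≡⟨ ℕSum.Σ-cong NZ (λ z m → Inner-GU z (NZ-≢ m)) ⟩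
    ℕSum.Σ NZ (λ z → p ℕ.* GU z)      ≡⟨ ℕSum.Σ-*ˡ NZ p GU ⟩
    p ℕ.* SX                          ≡⟨ cong (ℕ._* SX) p≡suc-p1 ⟩
    suc p1 ℕ.* SX                     ∎

module IntegerForm (L : FiniteField) (p r' n' : ℕ) (pp : Prime p)
                   (hN : FiniteField.card L ≡ (p ℕ.^ suc r') ℕ.^ suc n')
                   (B : List (FiniteField.Carrier L)) (cr : FiniteField.IsCosetReps L p (p ℕ.^ suc r') B) where
  open ListSums
  open ClosingArithmetic
  open TraceCounting L p r' n' pp hN B cr public
    using (q; q'; n; N; p1; p≡suc-p1; p>1; |U|+1; |NZ|+1; |B|; Fq00; S; U; curveCount)
  open PointCount L p r' n' pp hN B cr public
  open import Data.Integer using (_+_; _*_; _-_)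
  open ≡-Reasoning

  Q : ℕ
  Q = q ℕ.^ n'

  q≡p·q' : pos q ≡ (pos 1 + pos p1) * pos q'
  q≡p·q' = trans (ℤP.pos-* p q') (cong (_* pos q') (trans (cong pos p≡suc-p1) (ℤP.pos-+ 1 p1)))

  N≡q·Q : pos N ≡ pos q * pos Q
  N≡q·Q = trans (cong pos hN) (ℤP.pos-* q Q)

  nU≡q-1 : pos nU ≡ pos q - pos 1
  nU≡q-1 = cast-sub (trans (NP.+-comm nU 1) |U|+1)

  n₁≡N-1 : pos n₁ ≡ pos N - pos 1
  n₁≡N-1 = cast-sub |NZ|+1

  F≡1+a : pos (Fq00 q n) ≡ pos 1 + pos #RT0
  F≡1+a = trans (cong pos Fq00≡) (ℤP.pos-+ 1 #RT0)

  ΣGF≡ : pos ΣGF ≡ pos #RT0 * (pos q * pos q) + (pos n₁ - pos #RT0) * (pos q * pos q')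
  ΣGF≡ = trans (cast-pick #RT0 (q ℕ.* q') ΣGF-cases)
               (cong₂ (λ u v → pos #RT0 * u + (pos n₁ - pos #RT0) * v) (ℤP.pos-* q q) (ℤP.pos-* q q'))

  #T0≡Q-1 : pos #T0 ≡ pos Q - pos 1
  #T0≡Q-1 = cast-sub #T0+1

  ΣKR≡ : pos ΣKR ≡ pos #T0 * pos q + (pos n₁ - pos #T0) * pos q'
  ΣKR≡ = subst (λ c → pos ΣKR ≡ pos c * pos q + (pos n₁ - pos c) * pos q') #R0≡#T0
    (cast-pick #R0 q' ΣKR-cases)

  ΣKT≡ : pos ΣKT ≡ pos #T0 * pos q + (pos n₁ - pos #T0) * pos q'
  ΣKT≡ = cast-pick #T0 q' ΣKT-cases

  SX≡ : pos SX ≡ (pos ΣGF + pos n₁) - (pos ΣKR + pos ΣKT)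
  SX≡ = trans (cast-sub ΣGF+n₁) (cong₂ _-_ (ℤP.pos-+ ΣGF n₁) (ℤP.pos-+ ΣKR ΣKT))

  p₁·nB≡nU : pos p1 * pos nB ≡ pos nU
  p₁·nB≡nU = trans (sym (ℤP.pos-* p1 nB)) (cong pos |B|)

  p₁·SI≡p·SXℤ : pos p1 * pos SI ≡ (pos 1 + pos p1) * pos SX
  p₁·SI≡p·SXℤ = trans (sym (ℤP.pos-* p1 SI)) (trans (cong pos p₁·SI≡p·SX) (trans (ℤP.pos-* (suc p1) SX) (cong (_* pos SX) (ℤP.pos-+ 1 p1))))

  p₁≢0 : pos p1 ≢ pos 0
  p₁≢0 e = NP.<-irrefl refl (subst (1 <_) (trans p≡suc-p1 (cong suc (ℤP.+-injective e))) p>1)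

  lhs : pos (q ℕ.^ 2) * pos (Fq00 q n) ≡ pos q * pos q * pos (Fq00 q n)
  lhs = cong (_* pos (Fq00 q n)) (trans (cong (λ e → pos (q ℕ.* e)) (NP.*-identityʳ q)) (ℤP.pos-* q q))

  rhs : pos N + pos nU * pos nU + (pos 2 * (pos nU * pos nB) + pos SI - pos nU * (pos nB * (pos N + pos 1)))
        ≡ pos (q ℕ.^ n) + pos ((q ℕ.∸ 1) ℕ.^ 2) + sumℤ (λ α → sumℤ (λ β → S p α β) B) U
  rhs = cong₂ (λ u v → u + v) (cong₂ (λ u v → u + v) (cong pos hN) squares) (sym curve-sum)
    where
    squares : pos nU * pos nU ≡ pos ((q ℕ.∸ 1) ℕ.^ 2)
    squares = trans (sym (ℤP.pos-* nU nU))
      (cong pos (trans (cong (λ m → m ℕ.* m) (cong (ℕ._∸ 1) |U|+1)) (cong ((q ℕ.∸ 1) ℕ.*_) (sym (NP.*-identityʳ (q ℕ.∸ 1))))))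
    curve-sum : sumℤ (λ α → sumℤ (λ β → S p α β) B) U ≡ pos 2 * (pos nU * pos nB) + pos SI - pos nU * (pos nB * (pos N + pos 1))
    curve-sum = begin
      sumℤ (λ α → sumℤ (λ β → S p α β) B) U
        ≡⟨ sumℤ-cong _ _ U (λ α _ → sumℤ-shift (λ β → curveCount p α β) (N ℕ.+ 1) B) ⟩
      sumℤ (λ α → pos (ℕSum.Σ B (λ β → curveCount p α β)) - pos (nB ℕ.* (N ℕ.+ 1))) U
        ≡⟨ sumℤ-shift (λ α → ℕSum.Σ B (λ β → curveCount p α β)) (nB ℕ.* (N ℕ.+ 1)) U ⟩
      pos CC - pos (nU ℕ.* (nB ℕ.* (N ℕ.+ 1)))
        ≡⟨ cong₂ _-_ (trans (cong pos CC≡) (trans (ℤP.pos-+ (2 ℕ.* (nU ℕ.* nB)) SI) (cong (_+ pos SI) (trans (ℤP.pos-* 2 (nU ℕ.* nB)) (cong (pos 2 *_) (ℤP.pos-* nU nB))))))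
                     (trans (ℤP.pos-* nU (nB ℕ.* (N ℕ.+ 1))) (cong (pos nU *_) (trans (ℤP.pos-* nB (N ℕ.+ 1)) (cong (pos nB *_) (ℤP.pos-+ N 1))))) ⟩
      pos 2 * (pos nU * pos nB) + pos SI - pos nU * (pos nB * (pos N + pos 1)) ∎

open import Data.Nat using (ℕ; _≥_; _∸_; _^_)
open import Data.Integer using (ℤ; +_; _+_; _*_)
open import Data.List using (List)
open import Relation.Binary.PropositionalEquality using (_≡_)

-- Multiplied through by q²:  q² F_q(n,0,0) = q^n + (q-1)² + Σ_α Σ_β S_{α,β}(F_{q^n}).
theorem3 : (p r n : ℕ) → Prime p → r ≥ 1 → n ≥ 1 →
    (L : FiniteField) → FiniteField.card L ≡ (p ^ r) ^ n →
    (B : List (FiniteField.Carrier L)) → FiniteField.IsCosetReps L p (p ^ r) B →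
    (+ ((p ^ r) ^ 2)) * (+ FiniteField.Fq00 L (p ^ r) n)
    ≡ (+ ((p ^ r) ^ n)) + (+ (((p ^ r) ∸ 1) ^ 2))
    + sumℤ (λ α → sumℤ (λ β → FiniteField.S L p α β) B) (FiniteField.subUnits L (p ^ r))
theorem3 p (suc r') (suc n') pp _ _ L hN B cr =
  trans lhs (trans (closing (+ p1) (+ q') (+ Q) (+ #RT0) (+ #T0) (+ nB) (+ SI)
                           q≡p·q' N≡q·Q nU≡q-1 n₁≡N-1 F≡1+a ΣGF≡ #T0≡Q-1 ΣKR≡ ΣKT≡ SX≡ p₁·nB≡nU p₁·SI≡p·SXℤ p₁≢0)
                   rhs)
  where
  open ClosingArithmetic using (closing)
  open IntegerForm L p r' n' pp hN B cr
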